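{- Let $k\ge 2$ be a fixed integer. Then, as $n\to\infty$, $$\mu_{tsp,k}(C_n)\sim\left(1-\frac{1}{2^{k-1}}\right)n,$$ i.e. $\mu_{tsp,k}(C_n)\big/\big((1-2^{ -(k-1)})n\big)\to 1$.
   Context: $C_n$ is the cycle on $n$ vertices. For vertices $v_1,\dots,v_k$ of a graph, $\mathrm{tsp}_k(v_1,\dots,v_k)$ is the length of a shortest closed walk visiting all of them; $W_{tsp,k}(G)=\sum_{\{v_1,\dots,v_k\}\in\binom{V}{k}}\mathrm{tsp}_k(v_1,\dots,v_k)$ and $\mu_{tsp,k}(G)=W_{tsp,k}(G)/\binom{n}{k}$ for a graph $G$ of order $n$. -}

module Defs where

open import Data.Bool using (Bool; true; false; _∧_; _∨_; not; if_then_else_)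
open import Data.Nat using (ℕ; zero; suc; _≡ᵇ_; _∸_)
open import Data.Nat.Combinatorics using (_C_)
open import Data.Fin using (Fin; toℕ)
open import Data.Fin.Properties using (_≟_)
open import Data.Fin.Subset using (Subset; ∣_∣)
open import Data.Vec using (Vec; []; _∷_; lookup)
open import Data.List using (List; []; _∷_; map; concatMap; allFin; foldr)
open import Data.Bool.ListAction using (any; all)
open import Data.Integer using (+_)
open import Data.Rational using (ℚ; _/_; 1ℚ; 0ℚ; ½; _*_; _-_)
open import Relation.Nullary.Decidable using (⌊_⌋)

-- Vertex set of the cycle C_n is Fin n; i ~ j iff they differ by 1 mod n.
adjC : (n : ℕ) → Fin n → Fin n → Bool
adjC n i j = (suc (toℕ i) ≡ᵇ toℕ j) ∨ (suc (toℕ j) ≡ᵇ toℕ i)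
           ∨ ((toℕ i ≡ᵇ 0) ∧ (suc (toℕ j) ≡ᵇ n))
           ∨ ((toℕ j ≡ᵇ 0) ∧ (suc (toℕ i) ≡ᵇ n))

chainOK : (n : ℕ) → Fin n → Fin n → List (Fin n) → Bool
chainOK n x0 prev [] = ⌊ prev ≟ x0 ⌋
chainOK n x0 prev (x ∷ xs) = adjC n prev x ∧ chainOK n x0 x xs

-- a list w₀ w₁ … w_m is a closed walk (of length m) in C_n
isClosedWalk : (n : ℕ) → List (Fin n) → Bool
isClosedWalk n [] = false
isClosedWalk n (x ∷ xs) = chainOK n x x xs

visitsAll : (n : ℕ) → Subset n → List (Fin n) → Bool
visitsAll n S w = all (λ i → not (lookup S i) ∨ any (λ x → ⌊ x ≟ i ⌋) w) (allFin n)

seqs : (n : ℕ) → ℕ → List (List (Fin n))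
seqs n zero = [] ∷ []
seqs n (suc m) = concatMap (λ x → map (x ∷_) (seqs n m)) (allFin n)

hasWalk : (n : ℕ) → Subset n → ℕ → Bool
hasWalk n S m = any (λ w → isClosedWalk n w ∧ visitsAll n S w) (seqs n (suc m))

search : (n : ℕ) → Subset n → ℕ → ℕ → ℕ
search n S cur zero = cur
search n S cur (suc f) = if hasWalk n S cur then cur else search n S (suc cur) f

-- tsp(S) in C_n: length of a shortest closed walk visiting all of S.
-- (For n ≥ 3 a closed walk of length n around the cycle always exists,
--  so searching m = 0..n finds the true minimum.)
tsp : (n : ℕ) → Subset n → ℕ
tsp n S = search n S 0 n

subsets : (n : ℕ) → List (Subset n)
subsets zero = [] ∷ []
subsets (suc n) = concatMap (λ s → (true ∷ s) ∷ (false ∷ s) ∷ []) (subsets n)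

Wtsp : (k n : ℕ) → ℕ
Wtsp k n = foldr (λ S acc → (if ∣ S ∣ ≡ᵇ k then tsp n S else 0) Data.Nat.+ acc) 0 (subsets n)

-- μ_{tsp,k}(C_n) = W_{tsp,k}(C_n) / (n choose k)   (set to 0 when n < k)
μtsp : (k n : ℕ) → ℚ
μtsp k n with n C k
... | zero = 0ℚ
... | suc c = (+ Wtsp k n) / suc c

fromℕℚ : ℕ → ℚ
fromℕℚ n = (+ n) / 1

halfPow : ℕ → ℚ
halfPow zero = 1ℚ
halfPow (suc m) = ½ * halfPow m

target : (k n : ℕ) → ℚ
target k n = (1ℚ - halfPow (k ∸ 1)) * fromℕℚ n

module Submission where

-- A closed walk of length t < n in C_n cannot wind around the cycle, so it stays inside an arc and
-- runs through that arc twice: a vertex set S has tsp(S) ≤ t iff S lies in an arc of ⌊t/2⌋ edges.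
-- For nonempty S such an arc can be started at a vertex of S, and then its start is unique; by
-- rotational symmetry exactly n·C(⌊t/2⌋, k−1) of the k-sets have tsp ≤ t. Counting tsp(S) as
-- #{t < n : tsp(S) > t} yields the exact formula
--   W_{tsp,k}(C_n) + n Q = n C(n,k),   Q = Σ_{t<n} C(⌊t/2⌋, k−1) = C(⌊n/2⌋, k) + C(⌈n/2⌉, k).
-- Comparing falling factorials, 2^{k−1} Q ≤ C(n,k) ≤ 2^{k−1} Q + (k(k−1)/2) C(n,k)/⌊n/2⌋, so
-- μ_{tsp,k}(C_n) − (1 − 2^{1−k}) n = n (C(n,k) − 2^{k−1} Q) / (2^{k−1} C(n,k)) lies between 0 and a
-- constant depending only on k.

module Sums where

  open import Data.Bool using (Bool; true; false)
  open import Data.Fin.Subset using (Subset)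
  open import Data.Nat using (ℕ; zero; suc; _+_; _*_; _<_)
  open import Data.Nat.Properties
  open import Data.Nat.Tactic.RingSolver using (solve-∀)
  open import Data.Vec using ([]; _∷_; _∷ʳ_)
  open import Relation.Binary.PropositionalEquality

  𝟙 : Bool → ℕ
  𝟙 true = 1
  𝟙 false = 0

  sumRange : ℕ → (ℕ → ℕ) → ℕ
  sumRange zero f = 0
  sumRange (suc m) f = sumRange m f + f m

  sumSubsets : (n : ℕ) → (Subset n → ℕ) → ℕ
  sumSubsets zero F = F []
  sumSubsets (suc n) F = sumSubsets n (λ S → F (true ∷ S)) + sumSubsets n (λ S → F (false ∷ S))

  private
    interchange : ∀ a b c d → a + b + (c + d) ≡ a + c + (b + d)
    interchange = solve-∀

  sumRange-cong : ∀ m {f g : ℕ → ℕ} → (∀ t → t < m → f t ≡ g t) → sumRange m f ≡ sumRange m g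
  sumRange-cong zero eq = refl
  sumRange-cong (suc m) eq = cong₂ _+_ (sumRange-cong m (λ t t<m → eq t (m<n⇒m<1+n t<m))) (eq m ≤-refl)

  sumRange-const : ∀ m c → sumRange m (λ _ → c) ≡ m * c
  sumRange-const zero c = refl
  sumRange-const (suc m) c = trans (cong (_+ c) (sumRange-const m c)) (+-comm (m * c) c)

  sumRange-zero : ∀ m → sumRange m (λ _ → 0) ≡ 0
  sumRange-zero m = trans (sumRange-const m 0) (*-zeroʳ m)

  sumRange-+ : ∀ m f g → sumRange m (λ t → f t + g t) ≡ sumRange m f + sumRange m g
  sumRange-+ zero f g = refl
  sumRange-+ (suc m) f g =
    trans (cong (_+ (f m + g m)) (sumRange-+ m f g)) (interchange (sumRange m f) (sumRange m g) (f m) (g m))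

  sumRange-*ˡ : ∀ m c f → sumRange m (λ t → c * f t) ≡ c * sumRange m f
  sumRange-*ˡ zero c f = sym (*-zeroʳ c)
  sumRange-*ˡ (suc m) c f = trans (cong (_+ c * f m) (sumRange-*ˡ m c f)) (sym (*-distribˡ-+ c _ _))

  sumSubsets-cong : ∀ n {F G : Subset n → ℕ} → (∀ S → F S ≡ G S) → sumSubsets n F ≡ sumSubsets n G
  sumSubsets-cong zero eq = eq []
  sumSubsets-cong (suc n) eq =
    cong₂ _+_ (sumSubsets-cong n (λ S → eq (true ∷ S))) (sumSubsets-cong n (λ S → eq (false ∷ S)))

  sumSubsets-+ : ∀ n (F G : Subset n → ℕ) → sumSubsets n (λ S → F S + G S) ≡ sumSubsets n F + sumSubsets n G
  sumSubsets-+ zero F G = refl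
  sumSubsets-+ (suc n) F G =
    trans (cong₂ _+_ (sumSubsets-+ n _ _) (sumSubsets-+ n _ _))
          (interchange (sumSubsets n (λ S → F (true ∷ S))) (sumSubsets n (λ S → G (true ∷ S)))
                       (sumSubsets n (λ S → F (false ∷ S))) (sumSubsets n (λ S → G (false ∷ S))))

  sumSubsets-zero : ∀ n → sumSubsets n (λ _ → 0) ≡ 0
  sumSubsets-zero zero = refl
  sumSubsets-zero (suc n) = cong₂ _+_ (sumSubsets-zero n) (sumSubsets-zero n)

  sumSubsets-sumRange : ∀ n m (F : Subset n → ℕ → ℕ) →
                        sumSubsets n (λ S → sumRange m (F S)) ≡ sumRange m (λ t → sumSubsets n (λ S → F S t))
  sumSubsets-sumRange n zero F = sumSubsets-zero n
  sumSubsets-sumRange n (suc m) F =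
    trans (sumSubsets-+ n (λ S → sumRange m (F S)) (λ S → F S m))
          (cong (_+ sumSubsets n (λ S → F S m)) (sumSubsets-sumRange n m F))

  sumSubsets-∷ʳ : ∀ n (F : Subset (suc n) → ℕ) →
                  sumSubsets (suc n) F ≡ sumSubsets n (λ S → F (S ∷ʳ true)) + sumSubsets n (λ S → F (S ∷ʳ false))
  sumSubsets-∷ʳ zero F = refl
  sumSubsets-∷ʳ (suc n) F =
    trans (cong₂ _+_ (sumSubsets-∷ʳ n (λ S → F (true ∷ S))) (sumSubsets-∷ʳ n (λ S → F (false ∷ S))))
          (interchange (sumSubsets n (λ S → F (true ∷ (S ∷ʳ true)))) (sumSubsets n (λ S → F (true ∷ (S ∷ʳ false))))
                       (sumSubsets n (λ S → F (false ∷ (S ∷ʳ true)))) (sumSubsets n (λ S → F (false ∷ (S ∷ʳ false)))))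

  rotate : ∀ {n} → Subset n → Subset n
  rotate [] = []
  rotate (b ∷ S) = S ∷ʳ b

  sumSubsets-rotate : ∀ n (F : Subset n → ℕ) → sumSubsets n (λ S → F (rotate S)) ≡ sumSubsets n F
  sumSubsets-rotate zero F = refl
  sumSubsets-rotate (suc n) F = sym (sumSubsets-∷ʳ n F)

module Binomial where

  open import Data.Nat
  open import Data.Nat.Properties
  open import Data.Nat.Combinatorics using (_C_; nCk+nC[k+1]≡[n+1]C[k+1])
  open import Data.Nat.Tactic.RingSolver using (solve-∀)
  open import Data.Product using (∃-syntax; _,_)
  open import Data.Sum using (_⊎_; inj₁; inj₂)
  open import Relation.Binary.PropositionalEquality
  open import Relation.Nullary using (yes; no)
  open Sums

  binom : ℕ → ℕ → ℕ
  binom zero zero = 1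
  binom zero (suc k) = 0
  binom (suc n) zero = 1
  binom (suc n) (suc k) = binom n k + binom n (suc k)

  binom≡C : ∀ n k → binom n k ≡ n C k
  binom≡C zero zero = refl
  binom≡C zero (suc k) = refl
  binom≡C (suc n) zero = refl
  binom≡C (suc n) (suc k) = trans (cong₂ _+_ (binom≡C n k) (binom≡C n (suc k))) (nCk+nC[k+1]≡[n+1]C[k+1] n k)

  binom-zero : ∀ n → binom n 0 ≡ 1
  binom-zero zero = refl
  binom-zero (suc n) = refl

  binom-pos : ∀ {n k} → k ≤ n → 0 < binom n k
  binom-pos {zero} z≤n = z<s
  binom-pos {suc n} z≤n = z<s
  binom-pos {suc n} {suc k} (s≤s k≤n) = <-≤-trans (binom-pos k≤n) (m≤m+n (binom n k) (binom n (suc k)))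

  falling : ℕ → ℕ → ℕ
  falling n zero = 1
  falling n (suc k) = falling n k * (n ∸ k)

  falling-≡0 : ∀ {n k} → n < k → falling n k ≡ 0
  falling-≡0 {n} {suc k} n<1+k with m≤n⇒m<n∨m≡n (s≤s⁻¹ n<1+k)
  ... | inj₁ n<k = cong (_* (n ∸ k)) (falling-≡0 n<k)
  ... | inj₂ refl = trans (cong (falling n n *_) (n∸n≡0 n)) (*-zeroʳ (falling n n))

  falling-suc : ∀ n k → falling (suc n) (suc k) ≡ suc n * falling n k
  falling-suc n zero = *-comm 1 (suc n)
  falling-suc n (suc k) = trans (cong (_* (n ∸ k)) (falling-suc n k)) (*-assoc (suc n) (falling n k) (n ∸ k))

  falling-pascal : ∀ n k → suc k * falling n k + falling n (suc k) ≡ falling (suc n) (suc k)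
  falling-pascal n k = begin
    suc k * falling n k + falling n k * (n ∸ k)  ≡⟨ factor k (falling n k) (n ∸ k) ⟩
    falling n k * (suc k + (n ∸ k))              ≡⟨ collapse ⟩
    suc n * falling n k                          ≡⟨ falling-suc n k ⟨
    falling (suc n) (suc k)                      ∎
    where
    open ≡-Reasoning
    factor : ∀ k f d → suc k * f + f * d ≡ f * (suc k + d)
    factor = solve-∀
    collapse : falling n k * (suc k + (n ∸ k)) ≡ suc n * falling n k
    collapse with k ≤? n
    ... | yes k≤n = trans (cong (λ x → falling n k * suc x) (m+[n∸m]≡n k≤n)) (*-comm (falling n k) (suc n))
    ... | no k≰n rewrite falling-≡0 (≰⇒> k≰n) = sym (*-zeroʳ (suc n))

  binom*!≡falling : ∀ n k → binom n k * k ! ≡ falling n k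
  binom*!≡falling zero zero = refl
  binom*!≡falling zero (suc k) = sym (trans (cong (falling 0 k *_) (0∸n≡0 k)) (*-zeroʳ (falling 0 k)))
  binom*!≡falling (suc n) zero = refl
  binom*!≡falling (suc n) (suc k) = begin
    (binom n k + binom n (suc k)) * (suc k * k !)                ≡⟨ expand (binom n k) (binom n (suc k)) k (k !) ⟩
    suc k * (binom n k * k !) + binom n (suc k) * (suc k * k !)   ≡⟨ cong₂ (λ x y → suc k * x + y) (binom*!≡falling n k) (binom*!≡falling n (suc k)) ⟩
    suc k * falling n k + falling n (suc k)                       ≡⟨ falling-pascal n k ⟩
    falling (suc n) (suc k)                                       ∎
    where
    open ≡-Reasoning
    expand : ∀ a b k f → (a + b) * (suc k * f) ≡ suc k * (a * f) + b * (suc k * f)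
    expand = solve-∀

  triangle : ℕ → ℕ
  triangle zero = 0
  triangle (suc j) = triangle j + j

  2*[m∸j]≤[m+m]∸j : ∀ m j → 2 * (m ∸ j) ≤ (m + m) ∸ j
  2*[m∸j]≤[m+m]∸j m j with j ≤? m
  ... | yes j≤m = begin
    2 * (m ∸ j)        ≡⟨ cong ((m ∸ j) +_) (+-identityʳ (m ∸ j)) ⟩
    (m ∸ j) + (m ∸ j)  ≤⟨ +-monoʳ-≤ (m ∸ j) (m∸n≤m m j) ⟩
    (m ∸ j) + m        ≡⟨ +-∸-comm m j≤m ⟨
    (m + m) ∸ j        ∎
    where open ≤-Reasoning
  ... | no j≰m rewrite m≤n⇒m∸n≡0 (<⇒≤ (≰⇒> j≰m)) = z≤n

  2^j*falling≤falling-double : ∀ m j → 2 ^ j * falling m j ≤ falling (m + m) j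
  2^j*falling≤falling-double m zero = ≤-refl
  2^j*falling≤falling-double m (suc j) = begin
    2 * 2 ^ j * (falling m j * (m ∸ j))    ≡⟨ regroup (2 ^ j) (falling m j) (m ∸ j) ⟩
    2 ^ j * falling m j * (2 * (m ∸ j))    ≤⟨ *-mono-≤ (2^j*falling≤falling-double m j) (2*[m∸j]≤[m+m]∸j m j) ⟩
    falling (m + m) j * ((m + m) ∸ j)      ∎
    where
    open ≤-Reasoning
    regroup : ∀ p f d → 2 * p * (f * d) ≡ p * f * (2 * d)
    regroup = solve-∀

  -- The inductive step of the bound below, with m = j + u, so that (m + m) ∸ j = m + u.
  falling-double-step : ∀ m j u A B T → m ≡ j + u → B ≤ A → m * A ≤ m * B + T * A →
                        m * (A * (m + u)) ≤ m * (B * (2 * u)) + (T + j) * (A * (m + u))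
  falling-double-step m j u A B T refl B≤A IH = begin
    m * (A * (m + u))                           ≡⟨ *-assoc m A (m + u) ⟨
    m * A * (m + u)                             ≤⟨ *-monoˡ-≤ (m + u) IH ⟩
    (m * B + T * A) * (m + u)                   ≡⟨ split j u B T A ⟩
    m * (B * (2 * u)) + (j * (m * B) + T * (A * (m + u)))
        ≤⟨ +-monoʳ-≤ (m * (B * (2 * u))) (+-monoˡ-≤ (T * (A * (m + u))) (*-monoʳ-≤ j mB≤A[m+u])) ⟩
    m * (B * (2 * u)) + (j * (A * (m + u)) + T * (A * (m + u)))
        ≡⟨ cong (m * (B * (2 * u)) +_) (trans (sym (*-distribʳ-+ (A * (m + u)) j T)) (cong (_* (A * (m + u))) (+-comm j T))) ⟩
    m * (B * (2 * u)) + (T + j) * (A * (m + u)) ∎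
    where
    open ≤-Reasoning
    split : ∀ j u B T A → ((j + u) * B + T * A) * ((j + u) + u)
                        ≡ (j + u) * (B * (2 * u)) + (j * ((j + u) * B) + T * (A * ((j + u) + u)))
    split = solve-∀
    mB≤A[m+u] : m * B ≤ A * (m + u)
    mB≤A[m+u] = ≤-trans (*-mono-≤ (m≤m+n m u) B≤A) (≤-reflexive (*-comm (m + u) A))

  falling-double-bound : ∀ {m} j → j ≤ m → m * falling (m + m) j ≤ m * (2 ^ j * falling m j) + triangle j * falling (m + m) j
  falling-double-bound {m} zero _ = ≤-reflexive (solve m)
    where
    solve : ∀ m → m * 1 ≡ m * (1 * 1) + 0 * 1
    solve = solve-∀
  falling-double-bound {m} (suc j) j<m = begin
    m * (A * ((m + m) ∸ j))                     ≡⟨ cong (λ x → m * (A * x)) [m+m]∸j≡m+u ⟩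
    m * (A * (m + u))                           ≤⟨ falling-double-step m j u A B (triangle j) m≡j+u
                                                     (2^j*falling≤falling-double m j) (falling-double-bound j (<⇒≤ j<m)) ⟩
    m * (B * (2 * u)) + (triangle j + j) * (A * (m + u))
        ≡⟨ cong₂ (λ x y → m * x + (triangle j + j) * (A * y)) (regroup (2 ^ j) (falling m j) u) (sym [m+m]∸j≡m+u) ⟩
    m * (2 * 2 ^ j * (falling m j * u)) + (triangle j + j) * (A * ((m + m) ∸ j)) ∎
    where
    open ≤-Reasoning
    A = falling (m + m) j
    B = 2 ^ j * falling m j
    u = m ∸ j
    m≡j+u : m ≡ j + u
    m≡j+u = sym (m+[n∸m]≡n (<⇒≤ j<m))
    [m+m]∸j≡m+u : (m + m) ∸ j ≡ m + u
    [m+m]∸j≡m+u = +-∸-assoc m (<⇒≤ j<m)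
    regroup : ∀ p f u → p * f * (2 * u) ≡ 2 * p * (f * u)
    regroup = solve-∀

  2^j*binom≤binom-double : ∀ m j → 2 ^ j * binom m j ≤ binom (m + m) j
  2^j*binom≤binom-double m j = *-cancelʳ-≤ _ _ (j !) {{j !≢0}} (begin
    2 ^ j * binom m j * j !      ≡⟨ *-assoc (2 ^ j) (binom m j) (j !) ⟩
    2 ^ j * (binom m j * j !)    ≡⟨ cong (2 ^ j *_) (binom*!≡falling m j) ⟩
    2 ^ j * falling m j          ≤⟨ 2^j*falling≤falling-double m j ⟩
    falling (m + m) j            ≡⟨ binom*!≡falling (m + m) j ⟨
    binom (m + m) j * j !        ∎)
    where open ≤-Reasoning

  binom-double-bound : ∀ {m} j → j ≤ m → m * binom (m + m) j ≤ m * (2 ^ j * binom m j) + triangle j * binom (m + m) j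
  binom-double-bound {m} j j≤m = *-cancelʳ-≤ _ _ (j !) {{j !≢0}} (begin
    m * binom (m + m) j * j !                                     ≡⟨ *-assoc m _ (j !) ⟩
    m * (binom (m + m) j * j !)                                   ≡⟨ cong (m *_) (binom*!≡falling (m + m) j) ⟩
    m * falling (m + m) j                                         ≤⟨ falling-double-bound j j≤m ⟩
    m * (2 ^ j * falling m j) + triangle j * falling (m + m) j
        ≡⟨ cong₂ (λ x y → m * (2 ^ j * x) + triangle j * y) (binom*!≡falling m j) (binom*!≡falling (m + m) j) ⟨
    m * (2 ^ j * (binom m j * j !)) + triangle j * (binom (m + m) j * j !)
        ≡⟨ factor m (2 ^ j) (binom m j) (j !) (triangle j) (binom (m + m) j) ⟩
    (m * (2 ^ j * binom m j) + triangle j * binom (m + m) j) * j ! ∎)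
    where
    open ≤-Reasoning
    factor : ∀ m p b f t c → m * (p * (b * f)) + t * (c * f) ≡ (m * (p * b) + t * c) * f
    factor = solve-∀

  halfSum : ℕ → ℕ → ℕ
  halfSum r n = sumRange n (λ t → binom ⌊ t /2⌋ r)

  halfSum≡ : ∀ r n → halfSum r n ≡ binom ⌊ n /2⌋ (suc r) + binom ⌈ n /2⌉ (suc r)
  halfSum≡ r zero = refl
  halfSum≡ r (suc n) = trans (cong (_+ binom ⌊ n /2⌋ r) (halfSum≡ r n))
                             (rearrange (binom ⌊ n /2⌋ (suc r)) (binom ⌈ n /2⌉ (suc r)) (binom ⌊ n /2⌋ r))
    where
    rearrange : ∀ a b c → a + b + c ≡ b + (c + a)
    rearrange = solve-∀

  halfSum-even : ∀ r m → halfSum r (m + m) ≡ 2 * binom m (suc r)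
  halfSum-even r m rewrite halfSum≡ r (m + m) | sym (n≡⌊n+n/2⌋ m) | sym (n≡⌈n+n/2⌉ m) =
    cong (binom m (suc r) +_) (sym (+-identityʳ _))

  halfSum-odd : ∀ r m → halfSum r (suc (m + m)) ≡ 2 * binom m (suc r) + binom m r
  halfSum-odd r m rewrite halfSum≡ r (suc (m + m)) | sym (n≡⌊n+n/2⌋ m) | sym (n≡⌈n+n/2⌉ m) =
    rearrange (binom m (suc r)) (binom m r)
    where
    rearrange : ∀ a b → a + (b + a) ≡ 2 * a + b
    rearrange = solve-∀

  even⊎odd : ∀ n → ∃[ m ] (n ≡ m + m ⊎ n ≡ suc (m + m))
  even⊎odd zero = 0 , inj₁ refl
  even⊎odd (suc n) with even⊎odd n
  ... | m , inj₁ refl = m , inj₂ refl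
  ... | m , inj₂ refl = suc m , inj₁ (cong suc (sym (+-suc m m)))

  2^r*halfSum≤binom : ∀ r n → 2 ^ r * halfSum r n ≤ binom n (suc r)
  2^r*halfSum≤binom r n with even⊎odd n
  ... | m , inj₁ refl = begin
    2 ^ r * halfSum r (m + m)            ≡⟨ cong (2 ^ r *_) (halfSum-even r m) ⟩
    2 ^ r * (2 * binom m (suc r))        ≡⟨ regroup (2 ^ r) (binom m (suc r)) ⟩
    2 ^ suc r * binom m (suc r)          ≤⟨ 2^j*binom≤binom-double m (suc r) ⟩
    binom (m + m) (suc r)                ∎
    where
    open ≤-Reasoning
    regroup : ∀ p b → p * (2 * b) ≡ 2 * p * b
    regroup = solve-∀
  ... | m , inj₂ refl = begin
    2 ^ r * halfSum r (suc (m + m))                       ≡⟨ cong (2 ^ r *_) (halfSum-odd r m) ⟩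
    2 ^ r * (2 * binom m (suc r) + binom m r)             ≡⟨ regroup (2 ^ r) (binom m (suc r)) (binom m r) ⟩
    2 ^ r * binom m r + 2 ^ suc r * binom m (suc r)       ≤⟨ +-mono-≤ (2^j*binom≤binom-double m r) (2^j*binom≤binom-double m (suc r)) ⟩
    binom (m + m) r + binom (m + m) (suc r)               ∎
    where
    open ≤-Reasoning
    regroup : ∀ p b c → p * (2 * b + c) ≡ p * c + 2 * p * b
    regroup = solve-∀

  half*binom-bound : ∀ r n → suc r ≤ ⌊ n /2⌋ →
                     ⌊ n /2⌋ * binom n (suc r) ≤ ⌊ n /2⌋ * (2 ^ r * halfSum r n) + triangle (suc r) * binom n (suc r)
  half*binom-bound r n r<h with even⊎odd n
  ... | m , inj₁ refl rewrite sym (n≡⌊n+n/2⌋ m) = begin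
    m * binom (m + m) (suc r)                                                    ≤⟨ binom-double-bound (suc r) r<h ⟩
    m * (2 ^ suc r * binom m (suc r)) + K * binom (m + m) (suc r)
        ≡⟨ cong (λ x → m * x + K * binom (m + m) (suc r)) (regroup (2 ^ r) (binom m (suc r))) ⟩
    m * (2 ^ r * (2 * binom m (suc r))) + K * binom (m + m) (suc r)
        ≡⟨ cong (λ x → m * (2 ^ r * x) + K * binom (m + m) (suc r)) (halfSum-even r m) ⟨
    m * (2 ^ r * halfSum r (m + m)) + K * binom (m + m) (suc r)                  ∎
    where
    open ≤-Reasoning
    K = triangle (suc r)
    regroup : ∀ p b → 2 * p * b ≡ p * (2 * b)
    regroup = solve-∀
  ... | m , inj₂ refl rewrite sym (n≡⌈n+n/2⌉ m) = begin
    m * (binom (m + m) r + binom (m + m) (suc r))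
        ≡⟨ *-distribˡ-+ m _ _ ⟩
    m * binom (m + m) r + m * binom (m + m) (suc r)
        ≤⟨ +-mono-≤ (binom-double-bound r (≤-trans (n≤1+n r) r<h)) (binom-double-bound (suc r) r<h) ⟩
    (m * (2 ^ r * binom m r) + triangle r * binom (m + m) r) + (m * (2 ^ suc r * binom m (suc r)) + K * binom (m + m) (suc r))
        ≤⟨ +-monoˡ-≤ _ (+-monoʳ-≤ (m * (2 ^ r * binom m r)) (*-monoˡ-≤ (binom (m + m) r) (m≤m+n (triangle r) r))) ⟩
    (m * (2 ^ r * binom m r) + K * binom (m + m) r) + (m * (2 ^ suc r * binom m (suc r)) + K * binom (m + m) (suc r))
        ≡⟨ regroup m (2 ^ r) (binom m r) (binom m (suc r)) K (binom (m + m) r) (binom (m + m) (suc r)) ⟩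
    m * (2 ^ r * (2 * binom m (suc r) + binom m r)) + K * (binom (m + m) r + binom (m + m) (suc r))
        ≡⟨ cong (λ x → m * (2 ^ r * x) + K * (binom (m + m) r + binom (m + m) (suc r))) (halfSum-odd r m) ⟨
    m * (2 ^ r * halfSum r (suc (m + m))) + K * (binom (m + m) r + binom (m + m) (suc r)) ∎
    where
    open ≤-Reasoning
    K = triangle (suc r)
    regroup : ∀ m p a b K c d → (m * (p * a) + K * c) + (m * (2 * p * b) + K * d)
                              ≡ m * (p * (2 * b + a)) + K * (c + d)
    regroup = solve-∀

module CyclicDistance where

  open import Data.Bool using (true; false; if_then_else_; T)
  open import Data.Empty using (⊥; ⊥-elim)
  open import Data.Nat
  open import Data.Nat.Properties
  open import Data.Nat.Tactic.RingSolver using (solve-∀)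
  open import Data.Product using (_×_; _,_; ∃-syntax)
  open import Data.Sum using (_⊎_; inj₁; inj₂)
  open import Relation.Binary.PropositionalEquality
  open import Relation.Nullary using (contradiction)

  -- Vertices of C_n are the numbers below n; `next n i` is i + 1 mod n, and `fdist n a i` is the
  -- number of steps from a forward to i.
  next : ℕ → ℕ → ℕ
  next n i = if suc i ≡ᵇ n then 0 else suc i

  fdist : ℕ → ℕ → ℕ → ℕ
  fdist n a i = if a ≤ᵇ i then i ∸ a else n + i ∸ a

  Ahead : ℕ → ℕ → ℕ → ℕ → Set
  Ahead n a d i = a + d ≡ i ⊎ a + d ≡ n + i

  next-last : ∀ {n i} → suc i ≡ n → next n i ≡ 0
  next-last {n} {i} 1+i≡n with suc i ≡ᵇ n in eq
  ... | true = refl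
  ... | false = contradiction (≡⇒≡ᵇ (suc i) n 1+i≡n) (subst T eq)

  next-< : ∀ {n i} → suc i < n → next n i ≡ suc i
  next-< {n} {i} 1+i<n with suc i ≡ᵇ n in eq
  ... | false = refl
  ... | true = contradiction (≡ᵇ⇒≡ (suc i) n (subst T (sym eq) _)) (<⇒≢ 1+i<n)

  next-spec : ∀ {n i} → i < n → (suc i < n × next n i ≡ suc i) ⊎ (suc i ≡ n × next n i ≡ 0)
  next-spec i<n with m≤n⇒m<n∨m≡n i<n
  ... | inj₁ 1+i<n = inj₁ (1+i<n , next-< 1+i<n)
  ... | inj₂ 1+i≡n = inj₂ (1+i≡n , next-last 1+i≡n)

  next<n : ∀ {n i} → i < n → next n i < n
  next<n i<n with next-spec i<n
  ... | inj₁ (1+i<n , eq) = subst (_< _) (sym eq) 1+i<n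
  ... | inj₂ (1+i≡n , eq) = subst₂ _<_ (sym eq) 1+i≡n z<s

  next-surjective : ∀ {n j} → j < n → ∃[ i ] (i < n × next n i ≡ j)
  next-surjective {suc m} {zero} _ = m , ≤-refl , next-last refl
  next-surjective {n} {suc j} j<n = j , <-trans (n<1+n j) j<n , next-< j<n

  fdist-ahead : ∀ {n a i} → a < n → i < n → Ahead n a (fdist n a i) i
  fdist-ahead {n} {a} {i} a<n i<n with a ≤ᵇ i in eq
  ... | true = inj₁ (m+[n∸m]≡n (≤ᵇ⇒≤ a i (subst T (sym eq) _)))
  ... | false = inj₂ (m+[n∸m]≡n (≤-trans (<⇒≤ a<n) (m≤m+n n i)))

  fdist<n : ∀ {n a i} → a < n → i < n → fdist n a i < n
  fdist<n {n} {a} {i} a<n i<n with a ≤ᵇ i in eq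
  ... | true = ≤-<-trans (m∸n≤m i a) i<n
  ... | false = +-cancelˡ-< a _ n (begin-strict
    a + (n + i ∸ a)  ≡⟨ m+[n∸m]≡n (≤-trans (<⇒≤ a<n) (m≤m+n n i)) ⟩
    n + i            <⟨ +-monoʳ-< n i<a ⟩
    n + a            ≡⟨ +-comm n a ⟩
    a + n            ∎)
    where
    open ≤-Reasoning
    i<a : i < a
    i<a = ≰⇒> (λ a≤i → subst T eq (≤⇒≤ᵇ a≤i))

  private
    shift : ∀ n a d → n + (a + d) ≡ a + (n + d)
    shift = solve-∀

    no-double-wrap : ∀ {n a d d′ i} → d′ < n → a + d ≡ i → a + d′ ≡ n + i → ⊥
    no-double-wrap {n} {a} {d} {d′} d′<n e e′ = <⇒≱ d′<n (subst (n ≤_) (sym d′≡n+d) (m≤m+n n d))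
      where
      d′≡n+d : d′ ≡ n + d
      d′≡n+d = +-cancelˡ-≡ a _ _ (trans e′ (trans (cong (n +_) (sym e)) (shift n a d)))

  ahead-unique : ∀ {n a d d′ i} → d < n → d′ < n → Ahead n a d i → Ahead n a d′ i → d ≡ d′
  ahead-unique {a = a} _ _ (inj₁ e) (inj₁ e′) = +-cancelˡ-≡ a _ _ (trans e (sym e′))
  ahead-unique {a = a} _ _ (inj₂ e) (inj₂ e′) = +-cancelˡ-≡ a _ _ (trans e (sym e′))
  ahead-unique _ d′<n (inj₁ e) (inj₂ e′) = ⊥-elim (no-double-wrap d′<n e e′)
  ahead-unique d<n _ (inj₂ e) (inj₁ e′) = ⊥-elim (no-double-wrap d<n e′ e)

  fdist-unique : ∀ {n a i d} → a < n → i < n → d < n → Ahead n a d i → fdist n a i ≡ d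
  fdist-unique a<n i<n d<n = ahead-unique (fdist<n a<n i<n) d<n (fdist-ahead a<n i<n)

  fdist-refl : ∀ {n a} → a < n → fdist n a a ≡ 0
  fdist-refl a<n = fdist-unique a<n a<n (≤-<-trans z≤n a<n) (inj₁ (+-identityʳ _))

  fdist≡0⇒≡ : ∀ {n a i} → a < n → i < n → fdist n a i ≡ 0 → a ≡ i
  fdist≡0⇒≡ {n} {a} {i} a<n i<n d≡0 with fdist-ahead a<n i<n
  ... | inj₁ e = trans (sym (+-identityʳ a)) (trans (cong (a +_) (sym d≡0)) e)
  ... | inj₂ e = contradiction a<n (≤⇒≯ (begin
    n      ≤⟨ m≤m+n n i ⟩
    n + i  ≡⟨ e ⟨
    a + fdist n a i ≡⟨ cong (a +_) d≡0 ⟩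
    a + 0  ≡⟨ +-identityʳ a ⟩
    a      ∎))
    where open ≤-Reasoning

  fdist-from-0 : ∀ {n i} → i < n → fdist n 0 i ≡ i
  fdist-from-0 i<n = fdist-unique (≤-<-trans z≤n i<n) i<n i<n (inj₁ refl)

  ahead-next : ∀ {n a d i} → a < n → i < n → suc d < n → Ahead n a d i → Ahead n a (suc d) (next n i)
  ahead-next {n} {a} {d} {i} a<n i<n 1+d<n ahead with next-spec i<n | ahead
  ... | inj₁ (_ , eq) | inj₁ e = inj₁ (trans (+-suc a d) (trans (cong suc e) (sym eq)))
  ... | inj₁ (_ , eq) | inj₂ e = inj₂ (trans (+-suc a d) (trans (cong suc e) (trans (sym (+-suc n i)) (cong (n +_) (sym eq)))))
  ... | inj₂ (1+i≡n , eq) | inj₁ e = inj₂ (trans (+-suc a d) (trans (cong suc e) (trans 1+i≡n (sym (trans (cong (n +_) eq) (+-identityʳ n))))))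
  ... | inj₂ (1+i≡n , _) | inj₂ e = contradiction (+-mono-< a<n 1+d<n) (≤⇒≯ (begin
    n + n          ≡⟨ cong (n +_) 1+i≡n ⟨
    n + suc i      ≡⟨ +-suc n i ⟩
    suc (n + i)    ≡⟨ cong suc e ⟨
    suc (a + d)    ≡⟨ +-suc a d ⟨
    a + suc d      ∎))
    where open ≤-Reasoning

  ahead-wrap : ∀ {n a d i} → a < n → i < n → suc d ≡ n → Ahead n a d i → a ≡ next n i
  ahead-wrap {a = a} {d} {i} a<n i<n refl (inj₁ e) = trans a≡0 (sym (next-last (cong suc i≡d)))
    where
    a≡0 : a ≡ 0
    a≡0 = n≤0⇒n≡0 (+-cancelʳ-≤ d a 0 (subst (_≤ d) (sym e) (s≤s⁻¹ i<n)))
    i≡d : i ≡ d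
    i≡d = trans (sym e) (cong (_+ d) a≡0)
  ahead-wrap {a = a} {d} {i} a<n i<n refl (inj₂ e) = trans a≡1+i (sym (next-< (subst (_< _) a≡1+i a<n)))
    where
    a≡1+i : a ≡ suc i
    a≡1+i = +-cancelʳ-≡ d a (suc i) (trans e (cong suc (+-comm d i)))

  ahead-from-next : ∀ {n a d j} → a < n → j < n → Ahead n a (suc d) j → Ahead n (next n a) d j
  ahead-from-next {n} {a} {d} {j} a<n j<n ahead with next-spec a<n | ahead
  ... | inj₁ (_ , eq) | inj₁ e = inj₁ (trans (cong (_+ d) eq) (trans (sym (+-suc a d)) e))
  ... | inj₁ (_ , eq) | inj₂ e = inj₂ (trans (cong (_+ d) eq) (trans (sym (+-suc a d)) e))
  ... | inj₂ (1+a≡n , eq) | inj₁ e = contradiction j<n (≤⇒≯ (begin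
    n            ≡⟨ 1+a≡n ⟨
    suc a        ≤⟨ s≤s (m≤m+n a d) ⟩
    suc (a + d)  ≡⟨ +-suc a d ⟨
    a + suc d    ≡⟨ e ⟩
    j            ∎))
    where open ≤-Reasoning
  ... | inj₂ (1+a≡n , eq) | inj₂ e = inj₁ (trans (cong (_+ d) eq) (+-cancelˡ-≡ (suc a) d j (begin
    suc a + d    ≡⟨ +-suc a d ⟨
    a + suc d    ≡⟨ e ⟩
    n + j        ≡⟨ cong (_+ j) 1+a≡n ⟨
    suc a + j    ∎)))
    where open ≡-Reasoning

  ahead-to-next : ∀ {n a d v} → a < n → d < n → Ahead n (next n a) d v → Ahead n a (suc d) v
  ahead-to-next {n} {a} {d} {v} a<n d<n ahead with next-spec a<n | ahead
  ... | inj₁ (_ , eq) | inj₁ e = inj₁ (trans (+-suc a d) (trans (cong (_+ d) (sym eq)) e))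
  ... | inj₁ (_ , eq) | inj₂ e = inj₂ (trans (+-suc a d) (trans (cong (_+ d) (sym eq)) e))
  ... | inj₂ (1+a≡n , eq) | inj₁ e = inj₂ (trans (+-suc a d) (trans (cong (_+ d) 1+a≡n) (cong (n +_) (trans (cong (_+ d) (sym eq)) e))))
  ... | inj₂ (_ , eq) | inj₂ e = contradiction d<n (≤⇒≯ (subst (n ≤_) (sym (trans (cong (_+ d) (sym eq)) e)) (m≤m+n n v)))

  fdist-next-next : ∀ {n a i} → a < n → i < n → fdist n (next n a) (next n i) ≡ fdist n a i
  fdist-next-next {n} {a} {i} a<n i<n with m≤n⇒m<n∨m≡n (fdist<n a<n i<n)
  ... | inj₁ 1+d<n = fdist-unique (next<n a<n) (next<n i<n) (<-trans (n<1+n _) 1+d<n)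
                       (ahead-from-next a<n (next<n i<n) (ahead-next a<n i<n 1+d<n (fdist-ahead a<n i<n)))
  ... | inj₂ 1+d≡n = fdist-unique (next<n a<n) (next<n i<n) (fdist<n a<n i<n)
                       (subst (Ahead n (next n a) (fdist n a i)) (ahead-wrap a<n i<n 1+d≡n (fdist-ahead a<n i<n))
                          (ahead-from-next a<n a<n (inj₂ (trans (cong (a +_) 1+d≡n) (+-comm a n)))))

  fdist-next : ∀ {n a x} → a < n → x < n →
               (suc (fdist n a x) < n × fdist n a (next n x) ≡ suc (fdist n a x))
               ⊎ (suc (fdist n a x) ≡ n × fdist n a (next n x) ≡ 0)
  fdist-next {n} {a} {x} a<n x<n with m≤n⇒m<n∨m≡n (fdist<n a<n x<n)
  ... | inj₁ 1+d<n = inj₁ (1+d<n , fdist-unique a<n (next<n x<n) 1+d<n (ahead-next a<n x<n 1+d<n (fdist-ahead a<n x<n)))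
  ... | inj₂ 1+d≡n = inj₂ (1+d≡n , trans (cong (fdist n a) (sym (ahead-wrap a<n x<n 1+d≡n (fdist-ahead a<n x<n)))) (fdist-refl a<n))

  fdist-via-next : ∀ {n a v} → a < n → v < n → suc (fdist n (next n a) v) < n → fdist n a v ≡ suc (fdist n (next n a) v)
  fdist-via-next a<n v<n 1+d<n =
    fdist-unique a<n v<n 1+d<n (ahead-to-next a<n (fdist<n (next<n a<n) v<n) (fdist-ahead (next<n a<n) v<n))

  fdist-next-pred : ∀ {n a i d} → a < n → i < n → fdist n a i ≡ suc d → fdist n (next n a) i ≡ d
  fdist-next-pred {n} a<n i<n e =
    fdist-unique (next<n a<n) i<n (<-trans (n<1+n _) (subst (_< n) e (fdist<n a<n i<n)))
      (ahead-from-next a<n i<n (subst (λ d → Ahead n _ d _) e (fdist-ahead a<n i<n)))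

  fdist+fdist≡n : ∀ {n a b} → a < n → b < n → a ≢ b → fdist n a b + fdist n b a ≡ n
  fdist+fdist≡n {n} {a} {b} a<n b<n a≢b with fdist-ahead a<n b<n | fdist-ahead b<n a<n
  ... | inj₁ e₁ | inj₁ e₂ = contradiction (fdist≡0⇒≡ a<n b<n (m+n≡0⇒m≡0 _ (+-cancelˡ-≡ a _ 0 (begin
    a + (x + y)  ≡⟨ +-assoc a x y ⟨
    a + x + y    ≡⟨ cong (_+ y) e₁ ⟩
    b + y        ≡⟨ e₂ ⟩
    a            ≡⟨ +-identityʳ a ⟨
    a + 0        ∎)))) a≢b
    where
    open ≡-Reasoning
    x = fdist n a b
    y = fdist n b a
  ... | inj₁ e₁ | inj₂ e₂ = +-cancelˡ-≡ a _ n (trans (sym (+-assoc a _ _)) (trans (cong (_+ fdist n b a) e₁) (trans e₂ (+-comm n a))))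
  ... | inj₂ e₁ | inj₁ e₂ = trans (+-comm (fdist n a b) _)
      (+-cancelˡ-≡ b _ n (trans (sym (+-assoc b _ _)) (trans (cong (_+ fdist n a b) e₂) (trans e₁ (+-comm n b)))))
  ... | inj₂ e₁ | inj₂ e₂ = contradiction (+-monoʳ-< (a + b) (+-mono-< (fdist<n a<n b<n) (fdist<n b<n a<n))) (≤⇒≯ (begin
    a + b + (n + n)     ≡⟨ swap a b n ⟩
    (n + b) + (n + a)   ≡⟨ cong₂ _+_ e₁ e₂ ⟨
    (a + x) + (b + y)   ≡⟨ regroup a b x y ⟩
    a + b + (x + y)     ∎))
    where
    open ≤-Reasoning
    x = fdist n a b
    y = fdist n b a
    swap : ∀ a b n → a + b + (n + n) ≡ (n + b) + (n + a)
    swap = solve-∀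
    regroup : ∀ a b x y → (a + x) + (b + y) ≡ a + b + (x + y)
    regroup = solve-∀

module Walks where

  open import Data.Bool using (T; _∧_; _∨_)
  open import Data.Bool.Properties using (T-∨; T-∧)
  open import Data.Fin using (Fin; toℕ)
  open import Data.Fin.Properties using (toℕ<n; _≟_)
  open import Data.Nat hiding (_≟_)
  open import Data.Nat.Properties hiding (_≟_)
  open import Data.Nat.Tactic.RingSolver using (solve-∀)
  open import Data.List using (List; []; _∷_; length)
  open import Data.List.Relation.Unary.All using (All; []; _∷_)
  open import Data.Product using (_×_; _,_; Σ-syntax; ∃-syntax)
  open import Data.Sum using (_⊎_; inj₁; inj₂; [_,_]′)
  open import Function using (id)
  open import Function.Bundles using (module Equivalence)
  open import Relation.Binary.PropositionalEquality
  open import Relation.Nullary using (contradiction; yes)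
  open import Defs using (adjC; chainOK)
  open CyclicDistance

  open Equivalence using (to; from)

  -- T-∨ and T-∧ with the Boolean arguments made explicit: they cannot be inferred from T (a ∧ b).
  T-∨ˡ : ∀ {a} b → T a → T (a ∨ b)
  T-∨ˡ {a} b t = from (T-∨ {a} {b}) (inj₁ t)

  T-∨ʳ : ∀ a {b} → T b → T (a ∨ b)
  T-∨ʳ a {b} t = from (T-∨ {a} {b}) (inj₂ t)

  T-∨⁻ : ∀ a {b} → T (a ∨ b) → T a ⊎ T b
  T-∨⁻ a {b} = to (T-∨ {a} {b})

  T-∧⁻ : ∀ a {b} → T (a ∧ b) → T a × T b
  T-∧⁻ a {b} = to (T-∧ {a} {b})

  T-∧⁺ : ∀ {a b} → T a → T b → T (a ∧ b)
  T-∧⁺ {a} {b} x y = from (T-∧ {a} {b}) (x , y)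

  Step : ℕ → ℕ → ℕ → Set
  Step n q y = y ≡ next n q ⊎ q ≡ next n y

  private
    forward-form : ∀ {n i j} → j < n → T (suc i ≡ᵇ j) → j ≡ next n i
    forward-form j<n t = trans (sym e) (sym (next-< (subst (_< _) (sym e) j<n)))
      where e = ≡ᵇ⇒≡ _ _ t

    wrap-form : ∀ n {i j} → T ((j ≡ᵇ 0) ∧ (suc i ≡ᵇ n)) → j ≡ next n i
    wrap-form n {j = j} t with T-∧⁻ (j ≡ᵇ 0) t
    ... | j≡0 , 1+i≡n = trans (≡ᵇ⇒≡ _ _ j≡0) (sym (next-last (≡ᵇ⇒≡ (suc _) n 1+i≡n)))

    next-forms : ∀ {n i j} → i < n → j ≡ next n i → T (suc i ≡ᵇ j) ⊎ T ((j ≡ᵇ 0) ∧ (suc i ≡ᵇ n))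
    next-forms {n} {i} {j} i<n e with next-spec i<n
    ... | inj₁ (_ , eq) = inj₁ (≡⇒≡ᵇ (suc i) j (sym (trans e eq)))
    ... | inj₂ (1+i≡n , eq) = inj₂ (T-∧⁺ (≡⇒≡ᵇ j 0 (trans e eq)) (≡⇒≡ᵇ (suc i) n 1+i≡n))

  adjC⇒Step : ∀ {n} (i j : Fin n) → T (adjC n i j) → Step n (toℕ i) (toℕ j)
  adjC⇒Step {n} i j adj with T-∨⁻ (suc (toℕ i) ≡ᵇ toℕ j) adj
  ... | inj₁ A = inj₁ (forward-form (toℕ<n j) A)
  ... | inj₂ rest with T-∨⁻ (suc (toℕ j) ≡ᵇ toℕ i) rest
  ...   | inj₁ B = inj₂ (forward-form (toℕ<n i) B)
  ...   | inj₂ rest′ with T-∨⁻ ((toℕ i ≡ᵇ 0) ∧ (suc (toℕ j) ≡ᵇ n)) rest′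
  ...     | inj₁ C = inj₂ (wrap-form n C)
  ...     | inj₂ D = inj₁ (wrap-form n D)

  Step⇒adjC : ∀ {n} (i j : Fin n) → Step n (toℕ i) (toℕ j) → T (adjC n i j)
  Step⇒adjC {n} i j step = forms step
    where
    A = suc (toℕ i) ≡ᵇ toℕ j
    B = suc (toℕ j) ≡ᵇ toℕ i
    C = (toℕ i ≡ᵇ 0) ∧ (suc (toℕ j) ≡ᵇ n)
    D = (toℕ j ≡ᵇ 0) ∧ (suc (toℕ i) ≡ᵇ n)
    forms : Step n (toℕ i) (toℕ j) → T (A ∨ B ∨ C ∨ D)
    forms (inj₁ e) with next-forms (toℕ<n i) e
    ... | inj₁ a = T-∨ˡ _ a
    ... | inj₂ d = T-∨ʳ A (T-∨ʳ B (T-∨ʳ C d))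
    forms (inj₂ e) with next-forms (toℕ<n j) e
    ... | inj₁ b = T-∨ʳ A (T-∨ˡ _ b)
    ... | inj₂ c = T-∨ʳ A (T-∨ʳ B (T-∨ˡ _ c))

  -- A walk of length ℓ from position p to position q of an arc of length s that has visited
  -- both ends of the arc satisfies ℓ ≥ 2s − |p − q|.
  LongEnough : (s p q ℓ : ℕ) → Set
  LongEnough s p q ℓ = s + s + q ≤ ℓ + p ⊎ s + s + p ≤ ℓ + q

  module _ where
    open ≤-Reasoning

    longEnough⇒s≤ℓ : ∀ {s p q ℓ} → p ≤ s → q ≤ s → LongEnough s p q ℓ → s ≤ ℓ
    longEnough⇒s≤ℓ {s} {p} {q} {ℓ} p≤s q≤s (inj₁ le) = +-cancelʳ-≤ s s ℓ (begin
      s + s      ≤⟨ m≤m+n (s + s) q ⟩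
      s + s + q  ≤⟨ le ⟩
      ℓ + p      ≤⟨ +-monoʳ-≤ ℓ p≤s ⟩
      ℓ + s      ∎)
    longEnough⇒s≤ℓ {s} {p} {q} {ℓ} p≤s q≤s (inj₂ le) = +-cancelʳ-≤ s s ℓ (begin
      s + s      ≤⟨ m≤m+n (s + s) p ⟩
      s + s + p  ≤⟨ le ⟩
      ℓ + q      ≤⟨ +-monoʳ-≤ ℓ q≤s ⟩
      ℓ + s      ∎)

    longEnough-closed : ∀ {s p ℓ} → LongEnough s p p ℓ → s + s ≤ ℓ
    longEnough-closed {s} {p} {ℓ} le = +-cancelʳ-≤ p (s + s) ℓ ([ id , id ]′ le)

    longEnough-forward : ∀ {s p q ℓ} → LongEnough s p q ℓ → LongEnough s p (suc q) (suc ℓ)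
    longEnough-forward {s} {p} {q} {ℓ} (inj₁ le) = inj₁ (begin
      s + s + suc q    ≡⟨ +-suc (s + s) q ⟩
      suc (s + s + q)  ≤⟨ s≤s le ⟩
      suc ℓ + p        ∎)
    longEnough-forward {s} {p} {q} {ℓ} (inj₂ le) = inj₂ (begin
      s + s + p        ≤⟨ le ⟩
      ℓ + q            ≤⟨ +-mono-≤ (n≤1+n ℓ) (n≤1+n q) ⟩
      suc ℓ + suc q    ∎)

    longEnough-backward : ∀ {s p q ℓ} → LongEnough s p (suc q) ℓ → LongEnough s p q (suc ℓ)
    longEnough-backward {s} {p} {q} {ℓ} (inj₁ le) = inj₁ (begin
      s + s + q        ≤⟨ +-monoʳ-≤ (s + s) (n≤1+n q) ⟩
      s + s + suc q    ≤⟨ le ⟩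
      ℓ + p            ≤⟨ n≤1+n _ ⟩
      suc ℓ + p        ∎)
    longEnough-backward {s} {p} {q} {ℓ} (inj₂ le) = inj₂ (begin
      s + s + p        ≤⟨ le ⟩
      ℓ + suc q        ≡⟨ +-suc ℓ q ⟩
      suc ℓ + q        ∎)

    longEnough-at-end : ∀ {s p ℓ} → p ≤ s → LongEnough s p s ℓ → s + p ≤ ℓ
    longEnough-at-end {s} {p} {ℓ} p≤s (inj₁ le) = +-cancelʳ-≤ (p + s) (s + p) ℓ (begin
      s + p + (p + s)    ≤⟨ +-monoˡ-≤ (p + s) (+-monoʳ-≤ s p≤s) ⟩
      s + s + (p + s)    ≡⟨ rearrange s p ⟩
      s + s + s + p      ≤⟨ +-monoˡ-≤ p le ⟩
      ℓ + p + p          ≤⟨ +-monoʳ-≤ (ℓ + p) p≤s ⟩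
      ℓ + p + s          ≡⟨ +-assoc ℓ p s ⟩
      ℓ + (p + s)        ∎)
      where
      rearrange : ∀ s p → s + s + (p + s) ≡ s + s + s + p
      rearrange = solve-∀
    longEnough-at-end {s} {p} {ℓ} p≤s (inj₂ le) = +-cancelʳ-≤ s (s + p) ℓ (begin
      s + p + s    ≡⟨ rearrange s p ⟩
      s + s + p    ≤⟨ le ⟩
      ℓ + s        ∎)
      where
      rearrange : ∀ s p → s + p + s ≡ s + s + p
      rearrange = solve-∀

    longEnough-extend-forward : ∀ {s p ℓ} → p ≤ s → LongEnough s p s ℓ → LongEnough (suc s) p (suc s) (suc ℓ)
    longEnough-extend-forward {s} {p} {ℓ} p≤s le = inj₂ (begin
      suc s + suc s + p    ≡⟨ rearrange s p ⟩
      suc (s + p) + suc s  ≤⟨ +-monoˡ-≤ (suc s) (s≤s (longEnough-at-end p≤s le)) ⟩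
      suc ℓ + suc s        ∎)
      where
      rearrange : ∀ s p → suc s + suc s + p ≡ suc (s + p) + suc s
      rearrange = solve-∀

    longEnough-extend-backward : ∀ {s p ℓ} → LongEnough s p 0 ℓ → LongEnough (suc s) (suc p) 0 (suc ℓ)
    longEnough-extend-backward {s} {p} {ℓ} le = inj₁ (begin
      suc s + suc s + 0          ≡⟨ rearrange s ⟩
      suc (suc (s + s))          ≤⟨ s≤s (s≤s (at-start le)) ⟩
      suc (suc (ℓ + p))          ≡⟨ cong suc (+-suc ℓ p) ⟨
      suc ℓ + suc p              ∎)
      where
      rearrange : ∀ s → suc s + suc s + 0 ≡ suc (suc (s + s))
      rearrange = solve-∀
      at-start : LongEnough s p 0 ℓ → s + s ≤ ℓ + p
      at-start (inj₁ le) = ≤-trans (≤-reflexive (sym (+-identityʳ (s + s)))) le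
      at-start (inj₂ le) = ≤-trans (m≤m+n (s + s) p) (≤-trans le (≤-trans (≤-reflexive (+-identityʳ ℓ)) (m≤m+n ℓ p)))

  ArcExtends : (n a s a′ s′ : ℕ) → Set
  ArcExtends n a s a′ s′ = ∀ v → v < n → fdist n a v ≤ s → fdist n a′ v ≤ s′

  -- The arc swept so far by a walk from x₀ that has reached q after ℓ steps.
  record Sweep (n x₀ q ℓ : ℕ) : Set where
    constructor sweep
    field
      start len : ℕ
      start<n : start < n
      x₀∈ : fdist n start x₀ ≤ len
      q∈ : fdist n start q ≤ len
      long : LongEnough len (fdist n start x₀) (fdist n start q) ℓ

  open Sweep

  -- Stepping past either end of the arc lengthens it by one; as ℓ + 1 < n, it never closes up
  -- into the whole cycle.
  sweep-step : ∀ {n x₀ q y ℓ} → x₀ < n → q < n → y < n → suc ℓ < n → Step n q y → (σ : Sweep n x₀ q ℓ) →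
               Σ[ σ′ ∈ Sweep n x₀ y (suc ℓ) ] ArcExtends n (start σ) (len σ) (start σ′) (len σ′)
  sweep-step {n} {x₀} {q} {y} {ℓ} x₀<n q<n y<n 1+ℓ<n step (sweep a s a<n x₀∈ q∈ long) = go step
    where
    dp = fdist n a x₀
    dq = fdist n a q
    1+s<n : suc s < n
    1+s<n = ≤-<-trans (s≤s (longEnough⇒s≤ℓ x₀∈ q∈ long)) 1+ℓ<n

    same : ArcExtends n a s a s
    same _ _ v∈ = v∈

    go : Step n q y → Σ[ σ′ ∈ Sweep n x₀ y (suc ℓ) ] ArcExtends n a s (start σ′) (len σ′)
    go (inj₁ refl) with fdist-next a<n q<n
    ... | inj₂ (1+dq≡n , _) = contradiction 1+dq≡n (<⇒≢ (≤-<-trans (s≤s q∈) 1+s<n))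
    ... | inj₁ (_ , dy≡1+dq) with m≤n⇒m<n∨m≡n q∈
    ...   | inj₁ dq<s = sweep a s a<n x₀∈ (subst (_≤ s) (sym dy≡1+dq) dq<s)
                          (subst (λ d → LongEnough s dp d (suc ℓ)) (sym dy≡1+dq) (longEnough-forward {s} long)) , same
    ...   | inj₂ dq≡s = sweep a (suc s) a<n (m≤n⇒m≤1+n x₀∈) (≤-reflexive (trans dy≡1+dq (cong suc dq≡s)))
                          (subst (λ d → LongEnough (suc s) dp d (suc ℓ)) (sym (trans dy≡1+dq (cong suc dq≡s)))
                             (longEnough-extend-forward x₀∈ (subst (λ d → LongEnough s dp d ℓ) dq≡s long)))
                        , λ _ _ → m≤n⇒m≤1+n
    go (inj₂ refl) with fdist-next a<n y<n
    ... | inj₁ (_ , dq≡1+dy) = sweep a s a<n x₀∈ (≤-trans (n≤1+n _) (subst (_≤ s) dq≡1+dy q∈))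
                                 (longEnough-backward {s} (subst (λ d → LongEnough s dp d ℓ) dq≡1+dy long)) , same
    ... | inj₂ (_ , dq≡0) = sweep y (suc s) y<n (widen x₀<n x₀∈) (subst (_≤ suc s) (sym (fdist-refl y<n)) z≤n)
                              (subst₂ (λ u w → LongEnough (suc s) u w (suc ℓ)) (sym (shifted x₀<n x₀∈)) (sym (fdist-refl y<n))
                                 (longEnough-extend-backward {s} (subst (λ d → LongEnough s dp d ℓ) dq≡0 long)))
                          , λ _ → widen
      where
      a≡next-y : a ≡ next n y
      a≡next-y = fdist≡0⇒≡ a<n q<n dq≡0
      shifted : ∀ {v} → v < n → fdist n a v ≤ s → fdist n y v ≡ suc (fdist n a v)
      shifted {v} v<n v∈ = subst (λ z → fdist n y v ≡ suc (fdist n z v)) (sym a≡next-y)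
        (fdist-via-next y<n v<n (subst (λ z → suc (fdist n z v) < n) a≡next-y (≤-<-trans (s≤s v∈) 1+s<n)))
      widen : ∀ {v} → v < n → fdist n a v ≤ s → fdist n y v ≤ suc s
      widen v<n v∈ = subst (_≤ suc s) (sym (shifted v<n v∈)) (s≤s v∈)

  chain⇒arc : ∀ {n} (x₀ : Fin n) (xs : List (Fin n)) (q : Fin n) {ℓ} (σ : Sweep n (toℕ x₀) (toℕ q) ℓ) →
              T (chainOK n x₀ q xs) → ℓ + length xs < n →
              ∃[ a ] ∃[ s ] (a < n × s + s ≤ ℓ + length xs × ArcExtends n (start σ) (len σ) a s
                             × All (λ y → fdist n a (toℕ y) ≤ s) xs)
  chain⇒arc x₀ [] q σ chain _ with q ≟ x₀
  ... | yes refl = start σ , len σ , start<n σ , ≤-trans (longEnough-closed {len σ} (long σ)) (≤-reflexive (sym (+-identityʳ _)))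
                 , (λ _ _ v∈ → v∈) , []
  chain⇒arc {n} x₀ (y ∷ ys) q {ℓ} σ chain bound with T-∧⁻ (adjC n q y) chain
  ... | adj , chain′ with sweep-step (toℕ<n x₀) (toℕ<n q) (toℕ<n y) 1+ℓ<n (adjC⇒Step q y adj) σ
    where
    1+ℓ<n : suc ℓ < n
    1+ℓ<n = ≤-<-trans (≤-trans (s≤s (m≤m+n ℓ (length ys))) (≤-reflexive (sym (+-suc ℓ (length ys))))) bound
  ...   | σ′ , ext with chain⇒arc x₀ ys y σ′ chain′ (subst (_< n) (+-suc ℓ (length ys)) bound)
  ...     | a , s , a<n , 2s≤ , ext′ , ys∈ =
    a , s , a<n , ≤-trans 2s≤ (≤-reflexive (sym (+-suc ℓ (length ys))))
    , (λ v v<n v∈ → ext′ v v<n (ext v v<n v∈)) , ext′ (toℕ y) (toℕ<n y) (q∈ σ′) ∷ ys∈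

  closedWalk⇒arc : ∀ {n} (x : Fin n) (xs : List (Fin n)) → T (chainOK n x x xs) → length xs < n →
                   ∃[ a ] ∃[ s ] (a < n × s + s ≤ length xs × All (λ y → fdist n a (toℕ y) ≤ s) (x ∷ xs))
  closedWalk⇒arc {n} x xs closed bound with chain⇒arc x xs x initial closed bound
    where
    x∈ : fdist n (toℕ x) (toℕ x) ≤ 0
    x∈ = ≤-reflexive (fdist-refl (toℕ<n x))
    initial : Sweep n (toℕ x) (toℕ x) 0
    initial = sweep (toℕ x) 0 (toℕ<n x) x∈ x∈ (inj₁ ≤-refl)
  ... | a , s , a<n , 2s≤ , ext , xs∈ = a , s , a<n , 2s≤ , ext (toℕ x) (toℕ<n x) (≤-reflexive (fdist-refl (toℕ<n x))) ∷ xs∈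

module Arcs where

  open import Data.Bool using (Bool; true; false; T; _∨_; not)
  open import Data.Bool.ListAction using (any; all)
  open import Data.Fin using (Fin; toℕ; fromℕ<)
  open import Data.Fin.Properties using (toℕ<n; toℕ-fromℕ<; toℕ-injective; _≟_)
  open import Data.Fin.Subset using (Subset)
  open import Data.List using (List; []; _∷_; length; map; allFin; _++_)
  open import Data.List.Properties using (length-++)
  open import Data.List.Membership.Propositional using (_∈_; find; lose)
  open import Data.List.Membership.Propositional.Properties using (∈-allFin; ∈-map⁺; ∈-concat⁺′; ∈-++⁺ˡ)
  open import Data.List.Relation.Unary.All as All using (All; []; _∷_)
  open import Data.List.Relation.Unary.All.Properties using (all⁺; all⁻; concat⁺; map⁺)
  open import Data.List.Relation.Unary.Any as Any using (here; there)
  open import Data.List.Relation.Unary.Any.Properties using (any⁺; any⁻)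
  open import Data.Nat hiding (_≟_)
  open import Data.Nat.Properties hiding (_≟_)
  open import Data.Product using (_×_; _,_; ∃-syntax)
  open import Data.Sum using (inj₁; inj₂)
  open import Data.Vec using ([]; _∷_; lookup)
  open import Relation.Binary.PropositionalEquality
  open import Relation.Nullary using (yes)
  open import Relation.Nullary.Decidable using (⌊_⌋; toWitness; fromWitness)
  open import Defs
  open CyclicDistance
  open Walks

  member : ∀ {n} → Subset n → ℕ → Bool
  member [] i = false
  member (b ∷ S) zero = b
  member (b ∷ S) (suc i) = member S i

  lookup≡member : ∀ {n} (S : Subset n) (i : Fin n) → lookup S i ≡ member S (toℕ i)
  lookup≡member (b ∷ S) Fin.zero = refl
  lookup≡member (b ∷ S) (Fin.suc i) = lookup≡member S i

  member⇒< : ∀ {n} (S : Subset n) {i} → T (member S i) → i < n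
  member⇒< (b ∷ S) {zero} _ = z<s
  member⇒< (b ∷ S) {suc i} m = s<s (member⇒< S m)

  lookup-fromℕ< : ∀ {n} (S : Subset n) {i} (i<n : i < n) → lookup S (fromℕ< i<n) ≡ member S i
  lookup-fromℕ< S i<n = trans (lookup≡member S _) (cong (member S) (toℕ-fromℕ< i<n))

  covers : (n : ℕ) → Subset n → ℕ → ℕ → Bool
  covers n S a L = all (λ i → not (lookup S i) ∨ (fdist n a (toℕ i) ≤ᵇ L)) (allFin n)

  Covers : (n : ℕ) → Subset n → ℕ → ℕ → Set
  Covers n S a L = ∀ i → T (member S i) → fdist n a i ≤ L

  covers⁻ : ∀ {n} (S : Subset n) a {L} → T (covers n S a L) → Covers n S a L
  covers⁻ {n} S a {L} c i m = subst (λ j → fdist n a j ≤ L) (toℕ-fromℕ< i<n)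
    (≤ᵇ⇒≤ _ L (implied (All.lookup (all⁺ _ (allFin n) c) (∈-allFin (fromℕ< i<n)))))
    where
    i<n = member⇒< S m
    implied : ∀ {c} → T (not (lookup S (fromℕ< i<n)) ∨ c) → T c
    implied rewrite lookup-fromℕ< S i<n with member S i
    ... | true = λ c → c

  covers⁺ : ∀ {n} (S : Subset n) a {L} → Covers n S a L → T (covers n S a L)
  covers⁺ {n} S a {L} h = all⁻ _ (All.universal entry (allFin n))
    where
    entry : ∀ i → T (not (lookup S i) ∨ (fdist n a (toℕ i) ≤ᵇ L))
    entry i with lookup S i in eq
    ... | false = _
    ... | true = ≤⇒≤ᵇ (h (toℕ i) (subst T (trans (sym eq) (lookup≡member S i)) _))

  covers-mono : ∀ {n} (S : Subset n) a {L L′} → L ≤ L′ → T (covers n S a L) → T (covers n S a L′)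
  covers-mono S a L≤L′ c = covers⁺ S a (λ i m → ≤-trans (covers⁻ S a c i m) L≤L′)

  seqs-length : ∀ n l → All (λ w → length w ≡ l) (seqs n l)
  seqs-length n zero = refl ∷ []
  seqs-length n (suc l) = concat⁺ (map⁺ (All.universal (λ x → map⁺ (All.map (cong suc) (seqs-length n l))) (allFin n)))

  ∈-seqs : ∀ {n} (w : List (Fin n)) → w ∈ seqs n (length w)
  ∈-seqs [] = here refl
  ∈-seqs {n} (x ∷ w) = ∈-concat⁺′ (∈-map⁺ (x ∷_) (∈-seqs w)) (∈-map⁺ (λ y → map (y ∷_) (seqs n (length w))) (∈-allFin x))

  visitsAll⁻ : ∀ {n} (S : Subset n) w → T (visitsAll n S w) → ∀ i → T (lookup S i) → i ∈ w
  visitsAll⁻ {n} S w visits i i∈S = Any.map (λ t → sym (toWitness t)) (any⁻ _ w (implied (All.lookup (all⁺ _ (allFin n) visits) (∈-allFin i))))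
    where
    implied : ∀ {c} → T (not (lookup S i) ∨ c) → T c
    implied with lookup S i
    ... | true = λ c → c

  visitsAll⁺ : ∀ {n} (S : Subset n) w → (∀ i → T (lookup S i) → i ∈ w) → T (visitsAll n S w)
  visitsAll⁺ {n} S w h = all⁻ _ (All.universal entry (allFin n))
    where
    entry : ∀ i → T (not (lookup S i) ∨ any (λ x → ⌊ x ≟ i ⌋) w)
    entry i with lookup S i in eq
    ... | false = _
    ... | true = any⁺ _ (Any.map (λ x≡i → fromWitness (sym x≡i)) (h i (subst T (sym eq) _)))

  walk⇒arc : ∀ {n} (S : Subset n) m → T (hasWalk n S m) → m < n →
             ∃[ a ] ∃[ s ] (a < n × s + s ≤ m × T (covers n S a s))
  walk⇒arc {n} S m walk m<n with find (any⁻ _ (seqs n (suc m)) walk)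
  ... | x ∷ xs , w∈ , closed&visits =
    arc (T-∧⁻ (chainOK n x x xs) closed&visits) (suc-injective (All.lookup (seqs-length n (suc m)) w∈))
    where
    arc : T (chainOK n x x xs) × T (visitsAll n S (x ∷ xs)) → length xs ≡ m →
          ∃[ a ] ∃[ s ] (a < n × s + s ≤ m × T (covers n S a s))
    arc (closed , visits) refl with closedWalk⇒arc x xs closed m<n
    ... | a , s , a<n , 2s≤ , w⊆arc = a , s , a<n , 2s≤ , covers⁺ S a inArc
      where
      inArc : Covers n S a s
      inArc i i∈S = subst (λ j → fdist n a j ≤ s) (toℕ-fromℕ< i<n)
        (All.lookup w⊆arc (visitsAll⁻ S (x ∷ xs) visits (fromℕ< i<n) (subst T (sym (lookup-fromℕ< S i<n)) i∈S)))
        where i<n = member⇒< S i∈S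

  nextFin : ∀ {n} → Fin n → Fin n
  nextFin i = fromℕ< (next<n (toℕ<n i))

  -- a ∷ outAndBack a L is the closed walk a, a + 1, …, a + L, …, a + 1, a.
  outAndBack : ∀ {n} → Fin n → ℕ → List (Fin n)
  outAndBack a zero = []
  outAndBack a (suc L) = nextFin a ∷ (outAndBack (nextFin a) L ++ a ∷ [])

  length-outAndBack : ∀ {n} (a : Fin n) L → length (outAndBack a L) ≡ L + L
  length-outAndBack a zero = refl
  length-outAndBack a (suc L) = cong suc (begin
    length (outAndBack (nextFin a) L ++ a ∷ [])  ≡⟨ length-++ (outAndBack (nextFin a) L) ⟩
    length (outAndBack (nextFin a) L) + 1        ≡⟨ cong (_+ 1) (length-outAndBack (nextFin a) L) ⟩
    L + L + 1                                    ≡⟨ +-comm (L + L) 1 ⟩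
    suc (L + L)                                  ≡⟨ +-suc L L ⟨
    L + suc L                                    ∎)
    where open ≡-Reasoning

  chain-snoc : ∀ {n} (x₀ y p : Fin n) ws → T (chainOK n y p ws) → T (adjC n y x₀) → T (chainOK n x₀ p (ws ++ x₀ ∷ []))
  chain-snoc x₀ y p [] chain adj with p ≟ y
  ... | yes refl = T-∧⁺ adj (fromWitness refl)
  chain-snoc {n} x₀ y p (w ∷ ws) chain adj with T-∧⁻ (adjC n p w) chain
  ... | p~w , chain′ = T-∧⁺ p~w (chain-snoc x₀ y w ws chain′ adj)

  toℕ-nextFin : ∀ {n} (i : Fin n) → toℕ (nextFin i) ≡ next n (toℕ i)
  toℕ-nextFin i = toℕ-fromℕ< _

  closed-outAndBack : ∀ {n} (a : Fin n) L → T (chainOK n a a (outAndBack a L))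
  closed-outAndBack a zero = fromWitness refl
  closed-outAndBack a (suc L) =
    T-∧⁺ (Step⇒adjC a (nextFin a) (inj₁ (toℕ-nextFin a)))
         (chain-snoc a (nextFin a) (nextFin a) (outAndBack (nextFin a) L) (closed-outAndBack (nextFin a) L)
                     (Step⇒adjC (nextFin a) a (inj₂ (toℕ-nextFin a))))

  ∈-outAndBack : ∀ {n} (a i : Fin n) L → fdist n (toℕ a) (toℕ i) ≤ L → i ∈ a ∷ outAndBack a L
  ∈-outAndBack {n} a i L i∈arc with fdist n (toℕ a) (toℕ i) in eq
  ... | zero = here (sym (toℕ-injective (fdist≡0⇒≡ (toℕ<n a) (toℕ<n i) eq)))
  ∈-outAndBack {n} a i (suc L) (s≤s i∈arc) | suc d = there (shift (∈-outAndBack (nextFin a) i L (subst (_≤ L) (sym fdist≡d) i∈arc)))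
    where
    fdist≡d : fdist n (toℕ (nextFin a)) (toℕ i) ≡ d
    fdist≡d = trans (cong (λ z → fdist n z (toℕ i)) (toℕ-nextFin a)) (fdist-next-pred (toℕ<n a) (toℕ<n i) eq)
    shift : i ∈ nextFin a ∷ outAndBack (nextFin a) L → i ∈ nextFin a ∷ (outAndBack (nextFin a) L ++ a ∷ [])
    shift (here p) = here p
    shift (there m) = there (∈-++⁺ˡ m)

  arc⇒walk : ∀ {n} (S : Subset n) (a : Fin n) L → T (covers n S (toℕ a) L) → T (hasWalk n S (L + L))
  arc⇒walk {n} S a L c = any⁺ _ (lose w∈seqs (T-∧⁺ (closed-outAndBack a L) (visitsAll⁺ S w visited)))
    where
    w = a ∷ outAndBack a L
    w∈seqs : w ∈ seqs n (suc (L + L))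
    w∈seqs = subst (λ l → w ∈ seqs n (suc l)) (length-outAndBack a L) (∈-seqs w)
    visited : ∀ i → T (lookup S i) → i ∈ w
    visited i i∈S = ∈-outAndBack a i L (covers⁻ S (toℕ a) c (toℕ i) (subst T (lookup≡member S i) i∈S))

module TourLength where

  open import Data.Bool using (true; false; T)
  open import Data.Fin using (fromℕ<)
  open import Data.Fin.Properties using (toℕ-fromℕ<)
  open import Data.Fin.Subset using (Subset)
  open import Data.Nat
  open import Data.Nat.Properties
  open import Data.Product using (_×_; _,_; proj₂; ∃-syntax)
  open import Data.Sum using (inj₁; inj₂)
  open import Relation.Binary.PropositionalEquality
  open import Relation.Nullary using (¬_; yes; no; contradiction)
  open import Defs
  open Arcs

  module _ {n : ℕ} (S : Subset n) where

    search-bounds : ∀ cur f → cur ≤ search n S cur f × search n S cur f ≤ cur + f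
    search-bounds cur zero = ≤-refl , m≤m+n cur 0
    search-bounds cur (suc f) with hasWalk n S cur
    ... | true = ≤-refl , m≤m+n cur (suc f)
    ... | false with search-bounds (suc cur) f
    ...   | lower , upper = ≤-trans (n≤1+n cur) lower , ≤-trans upper (≤-reflexive (sym (+-suc cur f)))

    search-minimal : ∀ cur f m → cur ≤ m → m < search n S cur f → ¬ T (hasWalk n S m)
    search-minimal cur zero m cur≤m m<cur = contradiction cur≤m (<⇒≱ m<cur)
    search-minimal cur (suc f) m cur≤m m<res with hasWalk n S cur in eq
    ... | true = contradiction cur≤m (<⇒≱ m<res)
    ... | false with m≤n⇒m<n∨m≡n cur≤m
    ...   | inj₁ cur<m = search-minimal (suc cur) f m cur<m m<res
    ...   | inj₂ refl = subst T eq

    search-found : ∀ cur f → search n S cur f < cur + f → T (hasWalk n S (search n S cur f))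
    search-found cur zero res<cur = contradiction (sym (+-identityʳ cur)) (<⇒≢ res<cur)
    search-found cur (suc f) res< with hasWalk n S cur in eq
    ... | true = subst T (sym eq) _
    ... | false = search-found (suc cur) f (≤-trans res< (≤-reflexive (+-suc cur f)))

    tsp≤n : tsp n S ≤ n
    tsp≤n = proj₂ (search-bounds 0 n)

    ShortArc : ℕ → Set
    ShortArc t = ∃[ a ] ∃[ s ] (a < n × s + s ≤ t × T (covers n S a s))

    shortArc⇒tsp≤ : ∀ t → ShortArc t → tsp n S ≤ t
    shortArc⇒tsp≤ t (a , s , a<n , 2s≤t , c) with tsp n S ≤? t
    ... | yes tsp≤t = tsp≤t
    ... | no tsp≰t = contradiction (arc⇒walk S (fromℕ< a<n) s (subst (λ z → T (covers n S z s)) (sym (toℕ-fromℕ< a<n)) c))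
                                   (search-minimal 0 n (s + s) z≤n (≤-<-trans 2s≤t (≰⇒> tsp≰t)))

    tsp≤⇒shortArc : ∀ t → tsp n S ≤ t → t < n → ShortArc t
    tsp≤⇒shortArc t tsp≤t t<n with walk⇒arc S (tsp n S) (search-found 0 n (≤-<-trans tsp≤t t<n)) (≤-<-trans tsp≤t t<n)
    ... | a , s , a<n , 2s≤tsp , c = a , s , a<n , ≤-trans 2s≤tsp tsp≤t , c

module ShortTours where

  open import Data.Bool using (Bool; true; false; T; _∧_)
  open import Data.Fin.Subset using (Subset; ∣_∣)
  open import Data.Nat
  open import Data.Nat.Properties
  open import Data.Product using (_×_; _,_; proj₂; ∃-syntax)
  open import Data.Sum using (_⊎_; inj₁; inj₂)
  open import Data.Vec using (_∷_)
  open import Relation.Binary.PropositionalEquality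
  open import Relation.Nullary using (¬_; yes; no; contradiction)
  open import Defs using (tsp)
  open Sums
  open CyclicDistance
  open Walks using (T-∧⁻; T-∧⁺)
  open Arcs
  open TourLength

  nonempty : ∀ {n} (S : Subset n) {k} → ∣ S ∣ ≡ suc k → ∃[ i ] T (member S i)
  nonempty (true ∷ S) _ = 0 , _
  nonempty (false ∷ S) |S|≡1+k with nonempty S |S|≡1+k
  ... | i , i∈S = suc i , i∈S

  covering-start : ∀ {n} (S : Subset n) L b → b < n → T (covers n S b L) → ∀ {i} → T (member S i) →
                   ∃[ a ] (a < n × T (member S a) × T (covers n S a L))
  covering-start {n} S L b b<n c {i} i∈S with member S b in eb
  ... | true = b , b<n , subst T (sym eb) _ , c
  covering-start {n} S zero b b<n c {i} i∈S | false
    with fdist≡0⇒≡ b<n (member⇒< S i∈S) (n≤0⇒n≡0 (covers⁻ S b c i i∈S))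
  ... | refl = contradiction (subst T eb i∈S) λ ()
  covering-start {n} S (suc L) b b<n c i∈S | false
    with covering-start S L (next n b) (next<n b<n) (covers⁺ S (next n b) shrunk) i∈S
    where
    shrunk : Covers n S (next n b) L
    shrunk j j∈S with fdist n b j in eq | covers⁻ S b c j j∈S
    ... | zero | _ with fdist≡0⇒≡ b<n (member⇒< S j∈S) eq
    ...   | refl = contradiction (subst T eb j∈S) λ ()
    shrunk j j∈S | suc d | s≤s d≤L = subst (_≤ L) (sym (fdist-next-pred b<n (member⇒< S j∈S) eq)) d≤L
  ... | a , a<n , a∈S , c′ = a , a<n , a∈S , covers-mono S a (n≤1+n L) c′

  covering-start-unique : ∀ {n} (S : Subset n) L → L + L < n → ∀ {a a′} → a < n → a′ < n →
                          T (member S a) → T (member S a′) → T (covers n S a L) → T (covers n S a′ L) → a ≡ a′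
  covering-start-unique {n} S L 2L<n {a} {a′} a<n a′<n a∈S a′∈S c c′ with a ≟ a′
  ... | yes a≡a′ = a≡a′
  ... | no a≢a′ = contradiction (subst (_≤ L + L) (fdist+fdist≡n a<n a′<n a≢a′)
                                   (+-mono-≤ (covers⁻ S a c a′ a′∈S) (covers⁻ S a′ c′ a a∈S))) (<⇒≱ 2L<n)

  ⌊t/2⌋+⌊t/2⌋≤t : ∀ t → ⌊ t /2⌋ + ⌊ t /2⌋ ≤ t
  ⌊t/2⌋+⌊t/2⌋≤t t = ≤-trans (+-monoʳ-≤ ⌊ t /2⌋ (⌊n/2⌋≤⌈n/2⌉ t)) (≤-reflexive (⌊n/2⌋+⌈n/2⌉≡n t))

  s+s≤t⇒s≤⌊t/2⌋ : ∀ {s t} → s + s ≤ t → s ≤ ⌊ t /2⌋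
  s+s≤t⇒s≤⌊t/2⌋ {s} 2s≤t = subst (_≤ _) (sym (n≡⌊n+n/2⌋ s)) (⌊n/2⌋-mono 2s≤t)

  sumRange-𝟙 : ∀ (g : ℕ → Bool) m → (∀ {a b} → a < m → b < m → T (g a) → T (g b) → a ≡ b) →
               (sumRange m (λ a → 𝟙 (g a)) ≡ 1 × ∃[ a ] (a < m × T (g a)))
               ⊎ (sumRange m (λ a → 𝟙 (g a)) ≡ 0 × (∀ a → a < m → ¬ T (g a)))
  sumRange-𝟙 g zero _ = inj₂ (refl , λ _ ())
  sumRange-𝟙 g (suc m) unique with sumRange-𝟙 g m (λ a<m b<m → unique (m<n⇒m<1+n a<m) (m<n⇒m<1+n b<m)) | g m in eq
  ... | inj₁ (_ , a , a<m , ga) | true = contradiction (unique (m<n⇒m<1+n a<m) ≤-refl ga (subst T (sym eq) _)) (<⇒≢ a<m)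
  ... | inj₁ (sum≡1 , a , a<m , ga) | false = inj₁ (cong (_+ 0) sum≡1 , a , m<n⇒m<1+n a<m , ga)
  ... | inj₂ (sum≡0 , _) | true = inj₁ (cong (_+ 1) sum≡0 , m , ≤-refl , subst T (sym eq) _)
  ... | inj₂ (sum≡0 , none) | false = inj₂ (cong (_+ 0) sum≡0 , none′)
    where
    none′ : ∀ a → a < suc m → ¬ T (g a)
    none′ a a<1+m with m<1+n⇒m<n∨m≡n a<1+m
    ... | inj₁ a<m = none a a<m
    ... | inj₂ refl = subst T eq

  tsp≤-count : ∀ {n} (S : Subset n) {i} → T (member S i) → ∀ t → t < n →
               𝟙 (tsp n S ≤ᵇ t) ≡ sumRange n (λ a → 𝟙 (member S a ∧ covers n S a ⌊ t /2⌋))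
  tsp≤-count {n} S i∈S t t<n with sumRange-𝟙 (λ a → member S a ∧ covers n S a ⌊ t /2⌋) n unique | tsp n S ≤ᵇ t in eq
    where
    unique : ∀ {a b} → a < n → b < n → T (member S a ∧ covers n S a ⌊ t /2⌋) → T (member S b ∧ covers n S b ⌊ t /2⌋) → a ≡ b
    unique {a} {b} a<n b<n ga gb with T-∧⁻ (member S a) ga | T-∧⁻ (member S b) gb
    ... | a∈S , ca | b∈S , cb = covering-start-unique S ⌊ t /2⌋ (≤-<-trans (⌊t/2⌋+⌊t/2⌋≤t t) t<n) a<n b<n a∈S b∈S ca cb
  ... | inj₁ (sum≡1 , _) | true = sym sum≡1
  ... | inj₂ (sum≡0 , _) | false = sym sum≡0
  ... | inj₁ (_ , a , a<n , ga) | false = contradiction (subst T eq (≤⇒≤ᵇ tsp≤t)) λ ()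
    where
    tsp≤t : tsp n S ≤ t
    tsp≤t = shortArc⇒tsp≤ S t (a , ⌊ t /2⌋ , a<n , ⌊t/2⌋+⌊t/2⌋≤t t , proj₂ (T-∧⁻ (member S a) ga))
  ... | inj₂ (_ , none) | true with tsp≤⇒shortArc S t (≤ᵇ⇒≤ _ t (subst T (sym eq) _)) t<n
  ...   | b , s , b<n , 2s≤t , c with covering-start S ⌊ t /2⌋ b b<n (covers-mono S b (s+s≤t⇒s≤⌊t/2⌋ 2s≤t) c) i∈S
  ...     | a , a<n , a∈S , ca = contradiction (T-∧⁺ a∈S ca) (none a a<n)

  tsp≤-indicator : ∀ {n} (S : Subset n) k t → t < n →
                   𝟙 ((∣ S ∣ ≡ᵇ suc k) ∧ (tsp n S ≤ᵇ t))
                   ≡ sumRange n (λ a → 𝟙 ((∣ S ∣ ≡ᵇ suc k) ∧ (member S a ∧ covers n S a ⌊ t /2⌋)))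
  tsp≤-indicator {n} S k t t<n with ∣ S ∣ ≡ᵇ suc k in eq
  ... | false = sym (sumRange-zero n)
  ... | true = tsp≤-count S (proj₂ (nonempty S (≡ᵇ⇒≡ _ _ (subst T (sym eq) _)))) t t<n

module Counting where

  open import Data.Bool using (Bool; true; false; T; _∧_; not)
  open import Data.Empty using (⊥-elim)
  open import Data.Fin.Subset using (Subset; ∣_∣)
  open import Data.Nat
  open import Data.Nat.Properties
  open import Data.Product using (_,_)
  open import Data.Sum using (inj₁; inj₂)
  open import Data.Vec using ([]; _∷_; _∷ʳ_)
  open import Relation.Binary.PropositionalEquality
  open Sums
  open Binomial
  open CyclicDistance
  open Arcs

  T-ext : ∀ {x y : Bool} → (T x → T y) → (T y → T x) → x ≡ y
  T-ext {true} {true} _ _ = refl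
  T-ext {true} {false} f _ = ⊥-elim (f _)
  T-ext {false} {true} _ g = ⊥-elim (g _)
  T-ext {false} {false} _ _ = refl

  member-∷ʳ : ∀ {m} (S : Subset m) b {i} → i < m → member (S ∷ʳ b) i ≡ member S i
  member-∷ʳ (x ∷ S) b {zero} _ = refl
  member-∷ʳ (x ∷ S) b {suc i} i<m = member-∷ʳ S b (s<s⁻¹ i<m)

  member-∷ʳ-last : ∀ {m} (S : Subset m) b → member (S ∷ʳ b) m ≡ b
  member-∷ʳ-last [] b = refl
  member-∷ʳ-last (x ∷ S) b = member-∷ʳ-last S b

  member-rotate : ∀ {n} (S : Subset n) {i} → i < n → member (rotate S) i ≡ member S (next n i)
  member-rotate {suc m} (b ∷ S) {i} i<n with m≤n⇒m<n∨m≡n (s≤s⁻¹ i<n)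
  ... | inj₁ i<m = trans (member-∷ʳ S b i<m) (cong (member (b ∷ S)) (sym (next-< (s<s i<m))))
  ... | inj₂ refl = trans (member-∷ʳ-last S b) (cong (member (b ∷ S)) (sym (next-last {i = m} refl)))

  ∣∷ʳ∣ : ∀ {m} (S : Subset m) b → ∣ S ∷ʳ b ∣ ≡ ∣ b ∷ S ∣
  ∣∷ʳ∣ [] b = refl
  ∣∷ʳ∣ (true ∷ S) b = trans (cong suc (∣∷ʳ∣ S b)) (swap b)
    where
    swap : ∀ b → suc ∣ b ∷ S ∣ ≡ ∣ b ∷ true ∷ S ∣
    swap true = refl
    swap false = refl
  ∣∷ʳ∣ (false ∷ S) b = trans (∣∷ʳ∣ S b) (swap b)
    where
    swap : ∀ b → ∣ b ∷ S ∣ ≡ ∣ b ∷ false ∷ S ∣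
    swap true = refl
    swap false = refl

  ∣rotate∣ : ∀ {n} (S : Subset n) → ∣ rotate S ∣ ≡ ∣ S ∣
  ∣rotate∣ [] = refl
  ∣rotate∣ (b ∷ S) = ∣∷ʳ∣ S b

  covers-rotate : ∀ {n} (S : Subset n) {a} L → a < n → covers n (rotate S) a L ≡ covers n S (next n a) L
  covers-rotate {n} S {a} L a<n = T-ext (λ c → covers⁺ S (next n a) (forward c)) (λ c → covers⁺ (rotate S) a (backward c))
    where
    forward : T (covers n (rotate S) a L) → Covers n S (next n a) L
    forward c j j∈S with next-surjective (member⇒< S j∈S)
    ... | i , i<n , refl = subst (_≤ L) (sym (fdist-next-next a<n i<n))
                             (covers⁻ (rotate S) a c i (subst T (sym (member-rotate S i<n)) j∈S))
    backward : T (covers n S (next n a) L) → Covers n (rotate S) a L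
    backward c i i∈rS = subst (_≤ L) (fdist-next-next a<n i<n)
                          (covers⁻ S (next n a) c (next n i) (subst T (member-rotate S i<n) i∈rS))
      where i<n = member⇒< (rotate S) i∈rS

  within : ∀ {m} → ℕ → Subset m → Bool
  within L [] = true
  within zero (b ∷ S) = not b ∧ within zero S
  within (suc L) (b ∷ S) = within L S

  within⁻ : ∀ {m} L (S : Subset m) → T (within L S) → ∀ {i} → T (member S i) → i < L
  within⁻ zero (false ∷ S) w {suc i} i∈S with within⁻ zero S w i∈S
  ... | ()
  within⁻ (suc L) (b ∷ S) w {zero} _ = z<s
  within⁻ (suc L) (b ∷ S) w {suc i} i∈S = s<s (within⁻ L S w i∈S)

  within⁺ : ∀ {m} L (S : Subset m) → (∀ {i} → T (member S i) → i < L) → T (within L S)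
  within⁺ L [] _ = _
  within⁺ zero (true ∷ S) h with h {0} _
  ... | ()
  within⁺ zero (false ∷ S) h = within⁺ zero S (λ {i} i∈S → ⊥-elim (n≮0 (h {suc i} i∈S)))
  within⁺ (suc L) (b ∷ S) h = within⁺ L S (λ {i} i∈S → s<s⁻¹ (h {suc i} i∈S))

  private
    𝟙-∧-false : ∀ x → 𝟙 (x ∧ false) ≡ 0
    𝟙-∧-false true = refl
    𝟙-∧-false false = refl

  count-within : ∀ m L j → L ≤ m → sumSubsets m (λ S → 𝟙 ((∣ S ∣ ≡ᵇ j) ∧ within L S)) ≡ binom L j
  count-within zero zero zero _ = refl
  count-within zero zero (suc j) _ = refl
  count-within (suc m) zero j _ =
    cong₂ _+_ (trans (sumSubsets-cong m (λ S → 𝟙-∧-false (suc ∣ S ∣ ≡ᵇ j))) (sumSubsets-zero m)) (count-within m zero j z≤n)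
  count-within (suc m) (suc L) zero (s≤s L≤m) =
    trans (cong₂ _+_ (sumSubsets-zero m) (count-within m L 0 L≤m)) (trans (binom-zero L) (sym (binom-zero (suc L))))
  count-within (suc m) (suc L) (suc j) (s≤s L≤m) = cong₂ _+_ (count-within m L j L≤m) (count-within m L (suc j) L≤m)

  covers-from-0 : ∀ {m} (S : Subset m) L → covers (suc m) (true ∷ S) 0 L ≡ within L S
  covers-from-0 {m} S L = T-ext (λ c → within⁺ L S (forward c)) (λ w → covers⁺ (true ∷ S) 0 (backward w))
    where
    forward : T (covers (suc m) (true ∷ S) 0 L) → ∀ {i} → T (member S i) → i < L
    forward c {i} i∈S = subst (_≤ L) (fdist-from-0 (s<s (member⇒< S i∈S))) (covers⁻ (true ∷ S) 0 c (suc i) i∈S)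
    backward : T (within L S) → Covers (suc m) (true ∷ S) 0 L
    backward w zero _ = subst (_≤ L) (sym (fdist-from-0 {suc m} z<s)) z≤n
    backward w (suc i) i∈S = subst (_≤ L) (sym (fdist-from-0 (s<s (member⇒< S i∈S)))) (within⁻ L S w i∈S)

  startsAt : (n k L a : ℕ) → Subset n → ℕ
  startsAt n k L a S = 𝟙 ((∣ S ∣ ≡ᵇ k) ∧ (member S a ∧ covers n S a L))

  startsAt-rotate : ∀ n k L {a} (S : Subset n) → a < n → startsAt n k L a (rotate S) ≡ startsAt n k L (next n a) S
  startsAt-rotate n k L S a<n rewrite ∣rotate∣ S | member-rotate S a<n | covers-rotate S L a<n = refl

  count-startsAt-next : ∀ n k L {a} → a < n → sumSubsets n (startsAt n k L (next n a)) ≡ sumSubsets n (startsAt n k L a)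
  count-startsAt-next n k L a<n =
    trans (sumSubsets-cong n (λ S → sym (startsAt-rotate n k L S a<n))) (sumSubsets-rotate n (startsAt n k L _))

  count-startsAt-0 : ∀ n k L a → a < n → sumSubsets n (startsAt n k L a) ≡ sumSubsets n (startsAt n k L 0)
  count-startsAt-0 n k L zero _ = refl
  count-startsAt-0 n k L (suc a) 1+a<n = begin
    sumSubsets n (startsAt n k L (suc a))     ≡⟨ cong (λ b → sumSubsets n (startsAt n k L b)) (next-< 1+a<n) ⟨
    sumSubsets n (startsAt n k L (next n a))  ≡⟨ count-startsAt-next n k L a<n ⟩
    sumSubsets n (startsAt n k L a)           ≡⟨ count-startsAt-0 n k L a a<n ⟩
    sumSubsets n (startsAt n k L 0)           ∎
    where
    open ≡-Reasoning
    a<n = <-trans (n<1+n a) 1+a<n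

  count-startsAt : ∀ n k L a → a < n → L < n → sumSubsets n (startsAt n (suc k) L a) ≡ binom L k
  count-startsAt (suc m) k L a a<n L<n = begin
    sumSubsets (suc m) (startsAt (suc m) (suc k) L a)        ≡⟨ count-startsAt-0 (suc m) (suc k) L a a<n ⟩
    sumSubsets (suc m) (startsAt (suc m) (suc k) L 0)        ≡⟨ cong₂ _+_ (sumSubsets-cong m from-0) (trans (sumSubsets-cong m (λ _ → 𝟙-∧-false _)) (sumSubsets-zero m)) ⟩
    sumSubsets m (λ S → 𝟙 ((∣ S ∣ ≡ᵇ k) ∧ within L S)) + 0   ≡⟨ +-identityʳ _ ⟩
    sumSubsets m (λ S → 𝟙 ((∣ S ∣ ≡ᵇ k) ∧ within L S))       ≡⟨ count-within m L k (s≤s⁻¹ L<n) ⟩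
    binom L k                                                ∎
    where
    open ≡-Reasoning
    from-0 : ∀ S → startsAt (suc m) (suc k) L 0 (true ∷ S) ≡ 𝟙 ((∣ S ∣ ≡ᵇ k) ∧ within L S)
    from-0 S = cong (λ b → 𝟙 ((∣ S ∣ ≡ᵇ k) ∧ b)) (covers-from-0 S L)

module ExactFormula where

  open import Data.Bool using (true; false; T; _∧_; not; if_then_else_)
  open import Data.Fin.Subset using (Subset; ∣_∣)
  open import Data.List using ([]; _∷_; foldr; concatMap)
  open import Data.Nat
  open import Data.Nat.Properties
  open import Data.Vec using ([]; _∷_)
  open import Relation.Binary.PropositionalEquality
  open import Defs using (tsp; Wtsp; subsets)
  open Sums
  open Binomial
  open TourLength using (tsp≤n)
  open ShortTours using (tsp≤-indicator)
  open Counting using (startsAt; count-startsAt)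

  foldr-subsets : ∀ n (F : Subset n → ℕ) → foldr (λ S acc → F S + acc) 0 (subsets n) ≡ sumSubsets n F
  foldr-subsets zero F = +-identityʳ (F [])
  foldr-subsets (suc n) F = trans (pairs (subsets n)) (trans (foldr-subsets n _) (sumSubsets-+ n _ _))
    where
    pairs : ∀ l → foldr (λ S acc → F S + acc) 0 (concatMap (λ S → (true ∷ S) ∷ (false ∷ S) ∷ []) l)
                ≡ foldr (λ S acc → (F (true ∷ S) + F (false ∷ S)) + acc) 0 l
    pairs [] = refl
    pairs (S ∷ l) = trans (cong (λ x → F (true ∷ S) + (F (false ∷ S) + x)) (pairs l)) (sym (+-assoc (F (true ∷ S)) _ _))

  count-subsets : ∀ n j → sumSubsets n (λ S → 𝟙 (∣ S ∣ ≡ᵇ j)) ≡ binom n j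
  count-subsets zero zero = refl
  count-subsets zero (suc j) = refl
  count-subsets (suc n) zero = trans (cong₂ _+_ (sumSubsets-zero n) (count-subsets n 0)) (binom-zero n)
  count-subsets (suc n) (suc j) = cong₂ _+_ (count-subsets n j) (count-subsets n (suc j))

  count-below : ∀ x n → sumRange n (λ t → 𝟙 (not (x ≤ᵇ t))) ≡ x ⊓ n
  count-below x zero = sym (⊓-zeroʳ x)
  count-below x (suc n) with x ≤ᵇ n in eq
  ... | true = trans (+-identityʳ _) (trans (count-below x n) (trans (m≤n⇒m⊓n≡m x≤n) (sym (m≤n⇒m⊓n≡m (m≤n⇒m≤1+n x≤n)))))
    where x≤n = ≤ᵇ⇒≤ x n (subst T (sym eq) _)
  ... | false = trans (cong (_+ 1) (trans (count-below x n) (m≥n⇒m⊓n≡n (<⇒≤ n<x))))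
                      (trans (+-comm n 1) (sym (m≥n⇒m⊓n≡n n<x)))
    where n<x = ≰⇒> (λ x≤n → subst T eq (≤⇒≤ᵇ x≤n))

  count-short-tours : ∀ n k t → t < n →
                      sumSubsets n (λ S → 𝟙 ((∣ S ∣ ≡ᵇ suc k) ∧ (tsp n S ≤ᵇ t))) ≡ n * binom ⌊ t /2⌋ k
  count-short-tours n k t t<n = begin
    sumSubsets n (λ S → 𝟙 ((∣ S ∣ ≡ᵇ suc k) ∧ (tsp n S ≤ᵇ t)))   ≡⟨ sumSubsets-cong n (λ S → tsp≤-indicator S k t t<n) ⟩
    sumSubsets n (λ S → sumRange n (λ a → startsAt n (suc k) L a S)) ≡⟨ sumSubsets-sumRange n n _ ⟩
    sumRange n (λ a → sumSubsets n (startsAt n (suc k) L a))        ≡⟨ sumRange-cong n (λ a a<n → count-startsAt n k L a a<n L<n) ⟩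
    sumRange n (λ _ → binom L k)                                   ≡⟨ sumRange-const n _ ⟩
    n * binom L k                                                  ∎
    where
    open ≡-Reasoning
    L = ⌊ t /2⌋
    L<n : L < n
    L<n = ≤-<-trans (⌊n/2⌋≤n t) t<n

  tsp-as-count : ∀ n k (S : Subset n) →
                 (if ∣ S ∣ ≡ᵇ k then tsp n S else 0) ≡ sumRange n (λ t → 𝟙 ((∣ S ∣ ≡ᵇ k) ∧ not (tsp n S ≤ᵇ t)))
  tsp-as-count n k S with ∣ S ∣ ≡ᵇ k
  ... | true = sym (trans (count-below (tsp n S) n) (m≤n⇒m⊓n≡m (tsp≤n S)))
  ... | false = sym (sumRange-zero n)

  private
    𝟙-split : ∀ a b → 𝟙 (a ∧ not b) + 𝟙 (a ∧ b) ≡ 𝟙 a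
    𝟙-split true true = refl
    𝟙-split true false = refl
    𝟙-split false b = refl

  Wtsp-identity : ∀ k n → Wtsp (suc k) n + n * halfSum k n ≡ n * binom n (suc k)
  Wtsp-identity k n = begin
    Wtsp (suc k) n + n * halfSum k n
      ≡⟨ cong₂ _+_ (trans (foldr-subsets n _) (sumSubsets-cong n (tsp-as-count n (suc k)))) (sym (sumRange-*ˡ n n _)) ⟩
    sumSubsets n (λ S → sumRange n (long S)) + sumRange n (λ t → n * binom ⌊ t /2⌋ k)
      ≡⟨ cong (_+ sumRange n (λ t → n * binom ⌊ t /2⌋ k)) (sumSubsets-sumRange n n long) ⟩
    sumRange n (λ t → sumSubsets n (λ S → long S t)) + sumRange n (λ t → n * binom ⌊ t /2⌋ k)
      ≡⟨ sumRange-+ n _ _ ⟨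
    sumRange n (λ t → sumSubsets n (λ S → long S t) + n * binom ⌊ t /2⌋ k)
      ≡⟨ sumRange-cong n split ⟩
    sumRange n (λ _ → binom n (suc k))
      ≡⟨ sumRange-const n _ ⟩
    n * binom n (suc k) ∎
    where
    open ≡-Reasoning
    long : Subset n → ℕ → ℕ
    long S t = 𝟙 ((∣ S ∣ ≡ᵇ suc k) ∧ not (tsp n S ≤ᵇ t))
    split : ∀ t → t < n → sumSubsets n (λ S → long S t) + n * binom ⌊ t /2⌋ k ≡ binom n (suc k)
    split t t<n = begin
      sumSubsets n (λ S → long S t) + n * binom ⌊ t /2⌋ k
        ≡⟨ cong (sumSubsets n (λ S → long S t) +_) (count-short-tours n k t t<n) ⟨
      sumSubsets n (λ S → long S t) + sumSubsets n (λ S → 𝟙 ((∣ S ∣ ≡ᵇ suc k) ∧ (tsp n S ≤ᵇ t)))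
        ≡⟨ sumSubsets-+ n _ _ ⟨
      sumSubsets n (λ S → long S t + 𝟙 ((∣ S ∣ ≡ᵇ suc k) ∧ (tsp n S ≤ᵇ t)))
        ≡⟨ sumSubsets-cong n (λ S → 𝟙-split (∣ S ∣ ≡ᵇ suc k) (tsp n S ≤ᵇ t)) ⟩
      sumSubsets n (λ S → 𝟙 (∣ S ∣ ≡ᵇ suc k))
        ≡⟨ count-subsets n (suc k) ⟩
      binom n (suc k) ∎

module Rationals where

  open import Data.Integer as ℤ using (+_)
  import Data.Integer.Properties as ℤ
  open import Data.Integer.Tactic.RingSolver using (solve-∀)
  open import Data.Nat as ℕ using (ℕ; zero; suc)
  import Data.Nat.Properties as ℕ
  open import Data.Nat.Coprimality using (Coprime)
  open import Data.Rational
  open import Data.Rational.Properties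
  open import Data.Rational.Solver using (module +-*-Solver)
  open import Data.Rational.Unnormalised as ℚᵘ using (ℚᵘ; mkℚᵘ; *≡*; *<*; *≤*)
  import Data.Rational.Unnormalised.Properties as ℚᵘ
  open import Relation.Binary.PropositionalEquality
  open import Defs using (fromℕℚ; halfPow)

  open +-*-Solver using (solve; _:=_; _:+_; _:*_; _:-_; con)

  toℚᵘ-fromℕℚ : ∀ a → toℚᵘ (fromℕℚ a) ℚᵘ.≃ mkℚᵘ (+ a) 0
  toℚᵘ-fromℕℚ a = toℚᵘ-fromℚᵘ (mkℚᵘ (+ a) 0)

  fromℕℚ-+ : ∀ a b → fromℕℚ (a ℕ.+ b) ≡ fromℕℚ a + fromℕℚ b
  fromℕℚ-+ a b = toℚᵘ-injective (ℚᵘ.≃-trans (toℚᵘ-fromℕℚ (a ℕ.+ b)) (ℚᵘ.≃-sym (ℚᵘ.≃-trans (toℚᵘ-homo-+ (fromℕℚ a) (fromℕℚ b))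
    (ℚᵘ.≃-trans (ℚᵘ.+-cong (toℚᵘ-fromℕℚ a) (toℚᵘ-fromℕℚ b)) (*≡* (cross a b))))))
    where
    normalise : ∀ x y → (x ℤ.* + 1 ℤ.+ y ℤ.* + 1) ℤ.* + 1 ≡ (x ℤ.+ y) ℤ.* + 1
    normalise = solve-∀
    cross : ∀ a b → (+ a ℤ.* + 1 ℤ.+ + b ℤ.* + 1) ℤ.* + 1 ≡ + (a ℕ.+ b) ℤ.* + 1
    cross a b = trans (normalise (+ a) (+ b)) (cong (ℤ._* + 1) (sym (ℤ.pos-+ a b)))

  fromℕℚ-* : ∀ a b → fromℕℚ (a ℕ.* b) ≡ fromℕℚ a * fromℕℚ b
  fromℕℚ-* a b = toℚᵘ-injective (ℚᵘ.≃-trans (toℚᵘ-fromℕℚ (a ℕ.* b)) (ℚᵘ.≃-sym (ℚᵘ.≃-trans (toℚᵘ-homo-* (fromℕℚ a) (fromℕℚ b))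
    (ℚᵘ.≃-trans (ℚᵘ.*-cong (toℚᵘ-fromℕℚ a) (toℚᵘ-fromℕℚ b)) (*≡* (cong (ℤ._* + 1) (sym (ℤ.pos-* a b))))))))

  /-*-denominator : ∀ W c → ((+ W) / suc c) * fromℕℚ (suc c) ≡ fromℕℚ W
  /-*-denominator W c = toℚᵘ-injective (ℚᵘ.≃-trans (toℚᵘ-homo-* ((+ W) / suc c) (fromℕℚ (suc c)))
    (ℚᵘ.≃-trans (ℚᵘ.*-cong (toℚᵘ-fromℚᵘ (mkℚᵘ (+ W) c)) (toℚᵘ-fromℕℚ (suc c)))
    (ℚᵘ.≃-trans (*≡* (trans (ℤ.*-identityʳ _) (cong (+ W ℤ.*_) (cong +_ (sym (ℕ.*-identityʳ (suc c))))))) (ℚᵘ.≃-sym (toℚᵘ-fromℕℚ W)))))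

  halfPow*2^ : ∀ m → halfPow m * fromℕℚ (2 ℕ.^ m) ≡ 1ℚ
  halfPow*2^ zero = refl
  halfPow*2^ (suc m) = begin
    ½ * halfPow m * fromℕℚ (2 ℕ.* 2 ℕ.^ m)          ≡⟨ cong (½ * halfPow m *_) (fromℕℚ-* 2 (2 ℕ.^ m)) ⟩
    ½ * halfPow m * (fromℕℚ 2 * fromℕℚ (2 ℕ.^ m))   ≡⟨ solve 4 (λ a b c d → a :* b :* (c :* d) := (a :* c) :* (b :* d)) refl
                                                          ½ (halfPow m) (fromℕℚ 2) (fromℕℚ (2 ℕ.^ m)) ⟩
    (½ * fromℕℚ 2) * (halfPow m * fromℕℚ (2 ℕ.^ m)) ≡⟨ cong ((½ * fromℕℚ 2) *_) (halfPow*2^ m) ⟩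
    1ℚ                                               ∎
    where open ≡-Reasoning

  fromℕℚ-pos : ∀ x → 0ℚ < fromℕℚ (suc x)
  fromℕℚ-pos x = toℚᵘ-cancel-< (ℚᵘ.<-respʳ-≃ (ℚᵘ.≃-sym (toℚᵘ-fromℕℚ (suc x))) (*<* (ℤ.+<+ (ℕ.s≤s ℕ.z≤n))))

  fromℕℚ-nonNeg : ∀ x → 0ℚ ≤ fromℕℚ x
  fromℕℚ-nonNeg x = toℚᵘ-cancel-≤ (ℚᵘ.≤-respʳ-≃ (ℚᵘ.≃-sym (toℚᵘ-fromℕℚ x))
    (*≤* (subst (+ 0 ℤ.≤_) (sym (ℤ.*-identityʳ (+ x))) (ℤ.+≤+ ℕ.z≤n))))

  fromℕℚ<mkℚ*fromℕℚ : ∀ p q-1 .(cop : Coprime p (suc q-1)) a b → suc q-1 ℕ.* a ℕ.< p ℕ.* b →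
                fromℕℚ a < mkℚ (+ p) q-1 cop * fromℕℚ b
  fromℕℚ<mkℚ*fromℕℚ p q-1 cop a b lt = toℚᵘ-cancel-< (ℚᵘ.<-respˡ-≃ (ℚᵘ.≃-sym (toℚᵘ-fromℕℚ a))
    (ℚᵘ.<-respʳ-≃ (ℚᵘ.≃-sym (ℚᵘ.≃-trans (toℚᵘ-homo-* (mkℚ (+ p) q-1 cop) (fromℕℚ b)) (ℚᵘ.*-congˡ {mkℚᵘ (+ p) q-1} (toℚᵘ-fromℕℚ b))))
      (*<* cross)))
    where
    cross : + a ℤ.* + (suc q-1 ℕ.* 1) ℤ.< (+ p ℤ.* + b) ℤ.* + 1
    cross rewrite ℕ.*-identityʳ (suc q-1) | ℤ.*-identityʳ (+ p ℤ.* + b) | sym (ℤ.pos-* a (suc q-1)) | sym (ℤ.pos-* p b)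
      = ℤ.+<+ (subst (ℕ._< p ℕ.* b) (ℕ.*-comm (suc q-1) a) lt)

  *-<-scale : ∀ {q X p C} n P′ → 1 ℕ.≤ n → 1 ℕ.≤ P′ → q ℕ.* X ℕ.< p ℕ.* C → q ℕ.* (n ℕ.* X) ℕ.< p ℕ.* (n ℕ.* C ℕ.* P′)
  *-<-scale {q} {X} {p} {C} n P′ n≥1 P′≥1 qX<pC = begin-strict
    q ℕ.* (n ℕ.* X)           ≡⟨ swap q n X ⟩
    n ℕ.* (q ℕ.* X)           <⟨ ℕ.*-monoʳ-< n {{ℕ.>-nonZero n≥1}} qX<pC ⟩
    n ℕ.* (p ℕ.* C)           ≡⟨ swap n p C ⟩
    p ℕ.* (n ℕ.* C)           ≤⟨ ℕ.m≤m*n (p ℕ.* (n ℕ.* C)) P′ {{ℕ.>-nonZero P′≥1}} ⟩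
    p ℕ.* (n ℕ.* C) ℕ.* P′    ≡⟨ ℕ.*-assoc p (n ℕ.* C) P′ ⟩
    p ℕ.* (n ℕ.* C ℕ.* P′)    ∎
    where
    open ℕ.≤-Reasoning
    swap : ∀ a b c → a ℕ.* (b ℕ.* c) ≡ b ℕ.* (a ℕ.* c)
    swap a b c = trans (sym (ℕ.*-assoc a b c)) (trans (cong (ℕ._* c) (ℕ.*-comm a b)) (ℕ.*-assoc b a c))

  -- With C = X + 2^r Q and W = n (X + (2^r − 1) Q), clearing the denominator 2^r C turns
  -- W / C − (1 − 2^−r) n into n X and (1 − 2^−r) n into n C (2^r − 1).
  module ScaledError (r n W c X Q P′ : ℕ) (P≡2^r : suc P′ ≡ 2 ℕ.^ r)
                     (W≡ : W ≡ n ℕ.* (X ℕ.+ P′ ℕ.* Q)) (C≡ : suc c ≡ X ℕ.+ suc P′ ℕ.* Q) where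

    μ T D ρ : ℚ
    μ = (+ W) / suc c
    T = (1ℚ - halfPow r) * fromℕℚ n
    D = μ - T
    ρ = fromℕℚ (suc P′) * fromℕℚ (suc c)

    private
      h = halfPow r
      N = fromℕℚ n
      C = fromℕℚ (suc c)
      P = fromℕℚ (suc P′)
      P₁ = fromℕℚ P′
      Xq = fromℕℚ X
      Qq = fromℕℚ Q

      hP≡1 : h * P ≡ 1ℚ
      hP≡1 = subst (λ z → h * fromℕℚ z ≡ 1ℚ) (sym P≡2^r) (halfPow*2^ r)

      P≡1+P₁ : P ≡ 1ℚ + P₁
      P≡1+P₁ = fromℕℚ-+ 1 P′

      Wq≡ : fromℕℚ W ≡ N * (Xq + P₁ * Qq)
      Wq≡ = trans (cong fromℕℚ W≡) (trans (fromℕℚ-* n _) (cong (N *_) (trans (fromℕℚ-+ X _) (cong (λ z → Xq + z) (fromℕℚ-* P′ Q)))))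

      C≡′ : C ≡ Xq + (1ℚ + P₁) * Qq
      C≡′ = trans (cong fromℕℚ C≡) (trans (fromℕℚ-+ X _) (cong (λ z → Xq + z) (trans (fromℕℚ-* (suc P′) Q) (cong (_* Qq) P≡1+P₁))))

    open ≡-Reasoning

    excess-scaled : D * ρ ≡ fromℕℚ (n ℕ.* X)
    excess-scaled = begin
      (μ - (1ℚ - h) * N) * (P * C)
        ≡⟨ solve 5 (λ m h n P C → (m :- (con 1ℚ :- h) :* n) :* (P :* C) := (m :* C) :* P :- n :* C :* (P :- h :* P)) refl μ h N P C ⟩
      (μ * C) * P - N * C * (P - h * P)
        ≡⟨ cong₂ (λ x y → x * P - N * C * (P - y)) (/-*-denominator W c) hP≡1 ⟩
      fromℕℚ W * P - N * C * (P - 1ℚ)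
        ≡⟨ cong₂ (λ x y → x * y - N * C * (y - 1ℚ)) Wq≡ P≡1+P₁ ⟩
      (N * (Xq + P₁ * Qq)) * (1ℚ + P₁) - N * C * ((1ℚ + P₁) - 1ℚ)
        ≡⟨ cong (λ z → (N * (Xq + P₁ * Qq)) * (1ℚ + P₁) - N * z * ((1ℚ + P₁) - 1ℚ)) C≡′ ⟩
      (N * (Xq + P₁ * Qq)) * (1ℚ + P₁) - N * (Xq + (1ℚ + P₁) * Qq) * ((1ℚ + P₁) - 1ℚ)
        ≡⟨ solve 4 (λ n x q p → (n :* (x :+ p :* q)) :* (con 1ℚ :+ p) :- n :* (x :+ (con 1ℚ :+ p) :* q) :* ((con 1ℚ :+ p) :- con 1ℚ)
                                := n :* x) refl N Xq Qq P₁ ⟩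
      N * Xq
        ≡⟨ fromℕℚ-* n X ⟨
      fromℕℚ (n ℕ.* X) ∎

    target-scaled : T * ρ ≡ fromℕℚ (n ℕ.* suc c ℕ.* P′)
    target-scaled = begin
      (1ℚ - h) * N * (P * C)   ≡⟨ solve 4 (λ h n P C → (con 1ℚ :- h) :* n :* (P :* C) := n :* C :* (P :- h :* P)) refl h N P C ⟩
      N * C * (P - h * P)      ≡⟨ cong₂ (λ x y → N * C * (x - y)) P≡1+P₁ hP≡1 ⟩
      N * C * ((1ℚ + P₁) - 1ℚ) ≡⟨ solve 3 (λ n C p → n :* C :* ((con 1ℚ :+ p) :- con 1ℚ) := n :* C :* p) refl N C P₁ ⟩
      N * C * P₁               ≡⟨ trans (fromℕℚ-* (n ℕ.* suc c) P′) (cong (_* P₁) (fromℕℚ-* n (suc c))) ⟨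
      fromℕℚ (n ℕ.* suc c ℕ.* P′) ∎

    ρ-pos : Positive ρ
    ρ-pos = positive (subst (0ℚ <_) (fromℕℚ-* (suc P′) (suc c)) (fromℕℚ-pos (c ℕ.+ P′ ℕ.* suc c)))

    relative-error : ∀ p q-1 .(cop : Coprime (suc p) (suc q-1)) → 1 ℕ.≤ n → 1 ℕ.≤ P′ →
                     suc q-1 ℕ.* X ℕ.< suc p ℕ.* suc c → ∣ D ∣ < mkℚ (+ suc p) q-1 cop * T
    relative-error p q-1 cop n≥1 P′≥1 qX<pC = subst (_< ε * T) (sym (0≤p⇒∣p∣≡p D≥0)) D<εT
      where
      ε = mkℚ (+ suc p) q-1 cop
      Dρ<εTρ : D * ρ < ε * T * ρ
      Dρ<εTρ = subst₂ _<_ (sym excess-scaled) (sym (trans (*-assoc ε T ρ) (cong (ε *_) target-scaled)))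
                      (fromℕℚ<mkℚ*fromℕℚ (suc p) q-1 cop (n ℕ.* X) (n ℕ.* suc c ℕ.* P′) (*-<-scale {suc q-1} {X} {suc p} n P′ n≥1 P′≥1 qX<pC))
      D<εT : D < ε * T
      D<εT = *-cancelʳ-<-nonNeg ρ {{pos⇒nonNeg ρ {{ρ-pos}}}} Dρ<εTρ
      D≥0 : 0ℚ ≤ D
      D≥0 = *-cancelʳ-≤-pos ρ {{ρ-pos}} (subst₂ _≤_ (sym (*-zeroˡ ρ)) (sym excess-scaled) (fromℕℚ-nonNeg (n ℕ.* X)))

module Asymptotics where

  open import Data.Integer using (+_)
  open import Data.Nat
  open import Data.Nat.Combinatorics using (_C_)
  open import Data.Nat.Coprimality using (Coprime)
  open import Data.Nat.Properties
  open import Data.Nat.Tactic.RingSolver using (solve-∀)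
  open import Data.Product using (∃-syntax; _,_)
  open import Data.Rational as ℚ using (mkℚ; ∣_∣)
  open import Relation.Binary.PropositionalEquality
  open import Defs
  open Binomial
  open ExactFormula using (Wtsp-identity)
  open Rationals using (module ScaledError)

  module _ (r n : ℕ) where
    private
      B = binom n (suc r)
      P = 2 ^ r
      Q = halfSum r n
      h = ⌊ n /2⌋

    excess≤ : suc r ≤ h → h * (B ∸ P * Q) ≤ triangle (suc r) * B
    excess≤ r<h = ≤-trans (≤-reflexive (*-distribˡ-∸ h B (P * Q))) (m≤n+o⇒m∸n≤o (h * B) (h * (P * Q)) (half*binom-bound r n r<h))

    excess-small : ∀ q p → suc r ≤ h → q * triangle (suc r) < h → q * (B ∸ P * Q) < suc p * B
    excess-small q p r<h qK<h = *-cancelˡ-< h _ _ (begin-strict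
      h * (q * (B ∸ P * Q))     ≡⟨ swap h q (B ∸ P * Q) ⟩
      q * (h * (B ∸ P * Q))     ≤⟨ *-monoʳ-≤ q (excess≤ r<h) ⟩
      q * (triangle (suc r) * B) ≡⟨ *-assoc q (triangle (suc r)) B ⟨
      q * triangle (suc r) * B  <⟨ *-monoˡ-< B {{>-nonZero B>0}} qK<h ⟩
      h * B                     ≤⟨ *-monoʳ-≤ h (m≤m+n B (p * B)) ⟩
      h * (suc p * B)           ∎)
      where
      open ≤-Reasoning
      B>0 : B > 0
      B>0 = binom-pos (≤-trans r<h (⌊n/2⌋≤n n))
      swap : ∀ a b c → a * (b * c) ≡ b * (a * c)
      swap a b c = trans (sym (*-assoc a b c)) (trans (cong (_* c) (*-comm a b)) (*-assoc b a c))

    Wtsp≡ : Wtsp (suc r) n ≡ n * ((B ∸ P * Q) + (P ∸ 1) * Q)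
    Wtsp≡ = +-cancelʳ-≡ (n * Q) _ _ (begin
      Wtsp (suc r) n + n * Q                  ≡⟨ Wtsp-identity r n ⟩
      n * B                                   ≡⟨ cong (n *_) (m∸n+n≡m (2^r*halfSum≤binom r n)) ⟨
      n * ((B ∸ P * Q) + P * Q)               ≡⟨ cong (λ z → n * ((B ∸ P * Q) + z * Q)) (m+[n∸m]≡n (m^n>0 2 r)) ⟨
      n * ((B ∸ P * Q) + suc (P ∸ 1) * Q)     ≡⟨ split n (B ∸ P * Q) (P ∸ 1) Q ⟩
      n * ((B ∸ P * Q) + (P ∸ 1) * Q) + n * Q ∎)
      where
      open ≡-Reasoning
      split : ∀ n x p q → n * (x + suc p * q) ≡ n * (x + p * q) + n * q
      split = solve-∀

  μtsp-as-fraction : ∀ k n c → n C k ≡ suc c → μtsp k n ≡ (+ Wtsp k n) ℚ./ suc c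
  μtsp-as-fraction k n c eq rewrite eq = refl

  μtsp-relative-error : ∀ r n p q-1 .(cop : Coprime (suc p) (suc q-1)) →
                        suc (suc r) ≤ ⌊ n /2⌋ → suc q-1 * triangle (suc (suc r)) < ⌊ n /2⌋ →
                        ∣ μtsp (suc (suc r)) n ℚ.- target (suc (suc r)) n ∣ ℚ.< mkℚ (+ suc p) q-1 cop ℚ.* target (suc (suc r)) n
  μtsp-relative-error r n p q-1 cop k≤h qK<h =
    subst (λ μ → ∣ μ ℚ.- target k n ∣ ℚ.< mkℚ (+ suc p) q-1 cop ℚ.* target k n)
          (sym (μtsp-as-fraction k n c (trans (sym (binom≡C n k)) (sym 1+c≡B))))
          (ScaledError.relative-error (suc r) n (Wtsp k n) c X Q P′ P≡ (Wtsp≡ (suc r) n) B≡ p q-1 cop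
             (≤-trans (s≤s z≤n) (≤-trans k≤h (⌊n/2⌋≤n n))) P′≥1
             (subst (λ z → suc q-1 * X < suc p * z) (sym 1+c≡B) (excess-small (suc r) n (suc q-1) p k≤h qK<h)))
    where
    k = suc (suc r)
    B = binom n k
    c = B ∸ 1
    Q = halfSum (suc r) n
    X = B ∸ 2 ^ suc r * Q
    P′ = 2 ^ suc r ∸ 1
    1+c≡B : suc c ≡ B
    1+c≡B = m+[n∸m]≡n (binom-pos (≤-trans k≤h (⌊n/2⌋≤n n)))
    2≤P : 2 ≤ 2 ^ suc r
    2≤P = *-monoʳ-≤ 2 (m^n>0 2 r)
    P≡ : suc P′ ≡ 2 ^ suc r
    P≡ = m+[n∸m]≡n (≤-trans (s≤s z≤n) 2≤P)
    P′≥1 : 1 ≤ P′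
    P′≥1 = ∸-monoˡ-≤ 1 2≤P
    B≡ : suc c ≡ X + suc P′ * Q
    B≡ = trans 1+c≡B (trans (sym (m∸n+n≡m (2^r*halfSum≤binom (suc r) n))) (cong (λ z → X + z * Q) (sym P≡)))

  μtsp-eventually-close : ∀ r p q-1 .(cop : Coprime (suc p) (suc q-1)) → let k = suc (suc r) in
                          ∃[ N ] (∀ n → N ≤ n → ∣ μtsp k n ℚ.- target k n ∣ ℚ.< mkℚ (+ suc p) q-1 cop ℚ.* target k n)
  μtsp-eventually-close r p q-1 cop = H + H , λ n 2H≤n →
    let H≤h = subst (_≤ ⌊ n /2⌋) (sym (n≡⌊n+n/2⌋ H)) (⌊n/2⌋-mono 2H≤n) in
    μtsp-relative-error r n p q-1 cop (≤-trans (m≤n+m _ _) H≤h) (<-≤-trans (m<m+n (suc q-1 * K) z<s) H≤h)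
    where
    K = triangle (suc (suc r))
    H = suc q-1 * K + suc (suc r)

open import Data.Integer using (+_)
open import Data.Nat using (ℕ; _≤_; suc; z≤n; s≤s)
open import Data.Product using (∃-syntax)
open import Data.Rational using (ℚ; mkℚ; 0ℚ; _<_; _*_; _-_; ∣_∣; positive)
open import Defs
open Asymptotics using (μtsp-eventually-close)

mainTheorem6 : (k : ℕ) → 2 ≤ k → (ε : ℚ) → 0ℚ < ε → ∃[ N ] ((n : ℕ) → N ≤ n → ∣ μtsp k n - target k n ∣ < ε * target k n)
-- Abstracting ε together with its positivity evidence leaves only ε = mkℚ (+ suc p) q-1 _.
mainTheorem6 (suc (suc r)) (s≤s (s≤s z≤n)) ε 0<ε with ε | positive 0<ε
... | mkℚ (+ suc p) q-1 cop | _ = μtsp-eventually-close r p q-1 cop
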